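{- Let $\phi_1,\phi_2,\dots$ and $u$ be indeterminates, $\Phi(z)=1+\phi_1z+\phi_2z^2+\cdots$, and let $Z(u,y)$ be the unique formal power series solution $F=f_1y+f_2y^2+\cdots$ (no constant term) of $F^2\Phi(F)-2yF+(1-u^2)y^2=0$ with $f_1=1-u$ (its coefficients are Laurent polynomials in $u$ with coefficients polynomials in the $\phi_i$). Then for any nonnegative integer $r$, $Z(u,y)^r$ contains no even negative powers of $u$. -}

module Defs where

open import Data.Bool using (Bool; true; false; _∧_)
open import Data.Nat as ℕ using (ℕ; zero; suc)
open import Data.Integer as ℤ using (ℤ; +_)
open import Data.Rational as ℚ using (ℚ; 0ℚ; 1ℚ)
open import Data.List using (List; []; _∷_; _++_; map; concatMap; foldr; replicate; upTo)
open import Data.Product using (_×_; _,_)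
open import Relation.Nullary.Decidable using (does)
open import Relation.Binary.PropositionalEquality using (_≡_)
import Data.Integer.Properties as ℤP

-- Exponent vector of the φ's: the i-th entry (from 0) is the exponent
-- of φ_{i+1}; missing trailing entries mean exponent 0.
Exps : Set
Exps = List ℕ

-- A monomial: exponent of u (an integer) and exponents of the φ's.
Mono : Set
Mono = ℤ × Exps

addExps : Exps → Exps → Exps
addExps []       bs       = bs
addExps as       []       = as
addExps (a ∷ as) (b ∷ bs) = (a ℕ.+ b) ∷ addExps as bs

isZeroExps : Exps → Bool
isZeroExps []           = true
isZeroExps (zero  ∷ as) = isZeroExps as
isZeroExps (suc _ ∷ as) = false

eqExps : Exps → Exps → Bool
eqExps []       bs       = isZeroExps bs
eqExps (a ∷ as) []       = isZeroExps (a ∷ as)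
eqExps (a ∷ as) (b ∷ bs) = does (a ℕ.≟ b) ∧ eqExps as bs

eqMono : Mono → Mono → Bool
eqMono (e , as) (f , bs) = does (e ℤ.≟ f) ∧ eqExps as bs

mulMono : Mono → Mono → Mono
mulMono (e , as) (f , bs) = (e ℤ.+ f , addExps as bs)

Poly : Set
Poly = List (ℚ × Mono)

coeff : Poly → Mono → ℚ
coeff []             m = 0ℚ
coeff ((a , n) ∷ p)  m with eqMono n m
... | true  = a ℚ.+ coeff p m
... | false = coeff p m

infix 4 _≈P_
_≈P_ : Poly → Poly → Set
p ≈P q = ∀ m → coeff p m ≡ coeff q m

0P : Poly
0P = []

constP : ℚ → Poly
constP a = (a , (+ 0 , [])) ∷ []

1P : Poly
1P = constP 1ℚ

infixl 6 _+P_
infixl 7 _*P_ _·P_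

_+P_ : Poly → Poly → Poly
_+P_ = _++_

_·P_ : ℚ → Poly → Poly
a ·P p = map (λ { (b , m) → (a ℚ.* b , m) }) p

-P_ : Poly → Poly
-P p = ℚ.- 1ℚ ·P p

_*P_ : Poly → Poly → Poly
p *P q = concatMap (λ { (a , m) → map (λ { (b , n) → (a ℚ.* b , mulMono m n) }) q }) p

uP : Poly
uP = (1ℚ , (+ 1 , [])) ∷ []

-- the indeterminate φ_{k+1}
φP : ℕ → Poly
φP k = (1ℚ , (+ 0 , replicate k 0 ++ (1 ∷ []))) ∷ []

2ℚ : ℚ
2ℚ = 1ℚ ℚ.+ 1ℚ

-- Formal power series in y: the n-th entry is the coefficient of y^n.

Ser : Set
Ser = ℕ → Poly

sumP : List Poly → Poly
sumP = foldr _+P_ 0P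

infixl 7 _*S_
_*S_ : Ser → Ser → Ser
(f *S g) n = sumP (map (λ i → f i *P g (n ℕ.∸ i)) (upTo (suc n)))

1S : Ser
1S zero    = 1P
1S (suc n) = 0P

_^S_ : Ser → ℕ → Ser
f ^S zero  = 1S
f ^S suc r = f *S (f ^S r)

-- Φ(F) = 1 + Σ_{k ≥ 1} φ_k F^k, for F without constant term.
-- Since F^k has no terms of y-degree < k, the coefficient of y^n only
-- involves k = 1, …, n.
ΦS : Ser → Ser
ΦS F n = 1S n +P sumP (map (λ k → φP k *P (F ^S suc k) n) (upTo n))

yS : Ser → Ser
yS F zero    = 0P
yS F (suc n) = F n

cS : Ser
cS 2 = 1P +P -P (uP *P uP)
cS _ = 0P

eqnLHS : Ser → Ser
eqnLHS F n = ((F *S F) *S ΦS F) n +P (ℚ.- 2ℚ) ·P yS F n +P cS n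

IsZ : Ser → Set
IsZ F = (F 0 ≈P 0P)
      × (F 1 ≈P 1P +P -P uP)
      × (∀ n → eqnLHS F n ≈P 0P)

-- Write Z = y G and let Ḡ be G with u replaced by −u.  Both G and Ḡ are roots of
-- X² Φ(yX) − 2X + (1 − u²) = 0.  Subtracting the two equations, and combining them
-- crosswise, shows that G − Ḡ annihilates s + τ − 2 and p + τ′ − (1 − u²), where
-- s = G + Ḡ, p = G Ḡ, and τ, τ′ are sums of terms φ_{k+1} y^(k+1) times polynomials in
-- s and p (through the complete homogeneous symmetric polynomials in G and Ḡ).  As
-- G − Ḡ starts with −2u it is not a zero divisor, so these identities are recursions
-- which, thanks to the factors y^(k+1), determine s and p degree by degree in y
-- without ever dividing by u.  Hence s and p, and with them the polynomial
-- y^r (G^r + Ḡ^r) = Z^r + Z̄^r in s and p, have no negative powers of u; and the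
-- coefficient of an even power of u in Z^r is half that in Z^r + Z̄^r.

module Submission where

open import Defs
open import Algebra.Bundles using (CommutativeRing; RawRing)
open import Algebra.Morphism.Structures using (module RingMorphisms)
import Algebra.Properties.Semiring.Sum
open import Data.Bool using (Bool; true; false; _∧_; if_then_else_; T)
import Data.Bool.Properties as Boolₚ
open import Data.Fin as Fin using (Fin; toℕ)
open import Data.Integer as ℤ using (ℤ; +_; -[1+_])
import Data.Integer.Properties as ℤₚ
open import Data.Integer.Solver using () renaming (module +-*-Solver to ℤSolver)
open import Data.List using (List; []; _∷_; _++_; map; concatMap; foldr; upTo; applyUpTo)
import Data.List.Properties as Listₚ
open import Data.Maybe as Maybe using (Maybe; just; nothing; maybe′)
open import Data.Nat as ℕ using (ℕ; zero; suc; z≤n; s≤s; _<_; _≤_; _∸_)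
import Data.Nat.Properties as ℕₚ
open import Data.Product using (_×_; _,_; proj₁; proj₂)
open import Data.Rational as ℚ using (ℚ; 0ℚ; 1ℚ)
import Data.Rational.Properties as ℚₚ
open import Data.Rational.Solver using (module +-*-Solver)
open import Data.Sum using (inj₁; inj₂)
open import Data.Unit using (tt)
open import Function using (_∘_; id; mk⇔)
open import Level using (0ℓ)
open import Relation.Binary.PropositionalEquality as ≡ using (_≡_; cong; cong₂; subst)
open import Relation.Nullary using (yes; no; does)
open import Relation.Nullary.Decidable using (dec-false; does-⇔)

∑ₗ : {A : Set} → List A → (A → ℚ) → ℚ
∑ₗ []       f = 0ℚ
∑ₗ (x ∷ xs) f = f x ℚ.+ ∑ₗ xs f

module _ {A : Set} where

  ∑ₗ-cong : ∀ (xs : List A) {f g} → (∀ x → f x ≡ g x) → ∑ₗ xs f ≡ ∑ₗ xs g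
  ∑ₗ-cong []       f≡g = ≡.refl
  ∑ₗ-cong (x ∷ xs) f≡g = cong₂ ℚ._+_ (f≡g x) (∑ₗ-cong xs f≡g)

  ∑ₗ-++ : ∀ (xs ys : List A) f → ∑ₗ (xs ++ ys) f ≡ ∑ₗ xs f ℚ.+ ∑ₗ ys f
  ∑ₗ-++ []       ys f = ≡.sym (ℚₚ.+-identityˡ _)
  ∑ₗ-++ (x ∷ xs) ys f = ≡.trans (cong (f x ℚ.+_) (∑ₗ-++ xs ys f)) (≡.sym (ℚₚ.+-assoc (f x) _ _))

  ∑ₗ-zero : ∀ (xs : List A) → ∑ₗ xs (λ _ → 0ℚ) ≡ 0ℚ
  ∑ₗ-zero []       = ≡.refl
  ∑ₗ-zero (x ∷ xs) = ≡.trans (ℚₚ.+-identityˡ _) (∑ₗ-zero xs)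

  ∑ₗ-+ : ∀ (xs : List A) f g → ∑ₗ xs (λ x → f x ℚ.+ g x) ≡ ∑ₗ xs f ℚ.+ ∑ₗ xs g
  ∑ₗ-+ []       f g = ≡.refl
  ∑ₗ-+ (x ∷ xs) f g = ≡.trans (cong (f x ℚ.+ g x ℚ.+_) (∑ₗ-+ xs f g)) (interchange (f x) (g x) _ _)
    where
    open +-*-Solver
    interchange : ∀ a b c d → (a ℚ.+ b) ℚ.+ (c ℚ.+ d) ≡ (a ℚ.+ c) ℚ.+ (b ℚ.+ d)
    interchange = solve 4 (λ a b c d → (a :+ b) :+ (c :+ d) := (a :+ c) :+ (b :+ d)) ≡.refl

  ∑ₗ-*ˡ : ∀ (xs : List A) c f → ∑ₗ xs (λ x → c ℚ.* f x) ≡ c ℚ.* ∑ₗ xs f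
  ∑ₗ-*ˡ []       c f = ≡.sym (ℚₚ.*-zeroʳ c)
  ∑ₗ-*ˡ (x ∷ xs) c f = ≡.trans (cong (c ℚ.* f x ℚ.+_) (∑ₗ-*ˡ xs c f)) (≡.sym (ℚₚ.*-distribˡ-+ c _ _))

  ∑ₗ-*ʳ : ∀ (xs : List A) c f → ∑ₗ xs (λ x → f x ℚ.* c) ≡ ∑ₗ xs f ℚ.* c
  ∑ₗ-*ʳ xs c f = ≡.trans (∑ₗ-cong xs (λ x → ℚₚ.*-comm (f x) c))
                        (≡.trans (∑ₗ-*ˡ xs c f) (ℚₚ.*-comm c _))

module _ {A B : Set} where

  ∑ₗ-map : ∀ (g : A → B) xs f → ∑ₗ (map g xs) f ≡ ∑ₗ xs (f ∘ g)
  ∑ₗ-map g []       f = ≡.refl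
  ∑ₗ-map g (x ∷ xs) f = cong (f (g x) ℚ.+_) (∑ₗ-map g xs f)

  ∑ₗ-concatMap : ∀ (g : A → List B) xs f → ∑ₗ (concatMap g xs) f ≡ ∑ₗ xs (λ x → ∑ₗ (g x) f)
  ∑ₗ-concatMap g []       f = ≡.refl
  ∑ₗ-concatMap g (x ∷ xs) f =
    ≡.trans (∑ₗ-++ (g x) (concatMap g xs) f) (cong (∑ₗ (g x) f ℚ.+_) (∑ₗ-concatMap g xs f))

  ∑ₗ-comm : ∀ (xs : List A) (ys : List B) (f : A → B → ℚ) →
           ∑ₗ xs (λ x → ∑ₗ ys (f x)) ≡ ∑ₗ ys (λ y → ∑ₗ xs (λ x → f x y))
  ∑ₗ-comm []       ys f = ≡.sym (∑ₗ-zero ys)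
  ∑ₗ-comm (x ∷ xs) ys f = ≡.trans (cong (∑ₗ ys (f x) ℚ.+_) (∑ₗ-comm xs ys f))
                                 (≡.sym (∑ₗ-+ ys (f x) (λ y → ∑ₗ xs (λ x′ → f x′ y))))

when : Bool → ℚ → ℚ
when true  a = a
when false a = 0ℚ

when-*ˡ : ∀ b c a → when b (c ℚ.* a) ≡ c ℚ.* when b a
when-*ˡ true  c a = ≡.refl
when-*ˡ false c a = ≡.sym (ℚₚ.*-zeroʳ c)

when-*ʳ : ∀ b a c → when b (a ℚ.* c) ≡ when b a ℚ.* c
when-*ʳ true  a c = ≡.refl
when-*ʳ false a c = ≡.sym (ℚₚ.*-zeroˡ c)

addExps-identityʳ : ∀ as → addExps as [] ≡ as
addExps-identityʳ []       = ≡.refl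
addExps-identityʳ (a ∷ as) = ≡.refl

addExps-comm : ∀ as bs → addExps as bs ≡ addExps bs as
addExps-comm []       bs       = ≡.sym (addExps-identityʳ bs)
addExps-comm (a ∷ as) []       = ≡.refl
addExps-comm (a ∷ as) (b ∷ bs) = cong₂ _∷_ (ℕₚ.+-comm a b) (addExps-comm as bs)

addExps-assoc : ∀ as bs cs → addExps (addExps as bs) cs ≡ addExps as (addExps bs cs)
addExps-assoc []       bs       cs       = ≡.refl
addExps-assoc (a ∷ as) []       cs       = ≡.refl
addExps-assoc (a ∷ as) (b ∷ bs) []       = ≡.refl
addExps-assoc (a ∷ as) (b ∷ bs) (c ∷ cs) = cong₂ _∷_ (ℕₚ.+-assoc a b c) (addExps-assoc as bs cs)

mulMono-comm : ∀ m n → mulMono m n ≡ mulMono n m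
mulMono-comm (e , as) (f , bs) = cong₂ _,_ (ℤₚ.+-comm e f) (addExps-comm as bs)

mulMono-assoc : ∀ m n o → mulMono (mulMono m n) o ≡ mulMono m (mulMono n o)
mulMono-assoc (e , as) (f , bs) (g , cs) = cong₂ _,_ (ℤₚ.+-assoc e f g) (addExps-assoc as bs cs)

mulMono-identityˡ : ∀ m → mulMono (+ 0 , []) m ≡ m
mulMono-identityˡ (e , as) = cong (_, as) (ℤₚ.+-identityˡ e)

_∸ᴱ_ : Exps → Exps → Maybe Exps
ms       ∸ᴱ []       = just ms
[]       ∸ᴱ (b ∷ bs) = if isZeroExps (b ∷ bs) then just [] else nothing
(m ∷ ms) ∸ᴱ (b ∷ bs) = if b ℕ.≤ᵇ m then Maybe.map ((m ∸ b) ∷_) (ms ∸ᴱ bs) else nothing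

divMono : Mono → Mono → Maybe Mono
divMono (f , bs) (g , ms) = Maybe.map (g ℤ.- f ,_) (ms ∸ᴱ bs)

private

  eqExps-[]ʳ : ∀ as → eqExps as [] ≡ isZeroExps as
  eqExps-[]ʳ []       = ≡.refl
  eqExps-[]ʳ (a ∷ as) = ≡.refl

  eqExps-[]ˡ : ∀ as → eqExps [] as ≡ eqExps (0 ∷ []) as
  eqExps-[]ˡ []           = ≡.refl
  eqExps-[]ˡ (zero  ∷ as) = ≡.refl
  eqExps-[]ˡ (suc a ∷ as) = ≡.refl

  isZeroExps-addExps : ∀ as bs → isZeroExps (addExps as bs) ≡ isZeroExps as ∧ isZeroExps bs
  isZeroExps-addExps []           bs           = ≡.refl
  isZeroExps-addExps (a ∷ as)     []           = ≡.sym (Boolₚ.∧-identityʳ _)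
  isZeroExps-addExps (zero ∷ as)  (zero ∷ bs)  = isZeroExps-addExps as bs
  isZeroExps-addExps (zero ∷ as)  (suc b ∷ bs) = ≡.sym (Boolₚ.∧-zeroʳ _)
  isZeroExps-addExps (suc a ∷ as) (b ∷ bs)     = ≡.refl

  does-+≟-when-≤ : ∀ a b m → T (b ℕ.≤ᵇ m) → does (a ℕ.+ b ℕ.≟ m) ≡ does (a ℕ.≟ m ∸ b)
  does-+≟-when-≤ a b m b≤m = does-⇔ (mk⇔
    (λ a+b≡m → ≡.trans (≡.sym (ℕₚ.m+n∸n≡m a b)) (cong (_∸ b) a+b≡m))
    (λ a≡m∸b → ≡.trans (cong (ℕ._+ b) a≡m∸b) (ℕₚ.m∸n+n≡m (ℕₚ.≤ᵇ⇒≤ b m b≤m))))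
    (a ℕ.+ b ℕ.≟ m) (a ℕ.≟ m ∸ b)

  does-+≟-when-≰ : ∀ a b m → (b ℕ.≤ᵇ m) ≡ false → does (a ℕ.+ b ℕ.≟ m) ≡ false
  does-+≟-when-≰ a b m b≰m = dec-false (a ℕ.+ b ℕ.≟ m)
    (λ a+b≡m → subst T b≰m (ℕₚ.≤⇒≤ᵇ (subst (b ≤_) a+b≡m (ℕₚ.m≤n+m b a))))

  +-−-cancel : ∀ i j → i ℤ.+ j ℤ.- j ≡ i
  +-−-cancel = solve 2 (λ i j → i :+ j :- j := i) ≡.refl
    where open ℤSolver

  −-+-cancel : ∀ i j → i ℤ.- j ℤ.+ j ≡ i
  −-+-cancel = solve 2 (λ i j → i :- j :+ j := i) ≡.refl
    where open ℤSolver

  does-+≟ℤ : ∀ e f g → does (e ℤ.+ f ℤ.≟ g) ≡ does (e ℤ.≟ g ℤ.- f)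
  does-+≟ℤ e f g = does-⇔ (mk⇔
    (λ e+f≡g → ≡.trans (≡.sym (+-−-cancel e f)) (cong (ℤ._- f) e+f≡g))
    (λ e≡g-f → ≡.trans (cong (ℤ._+ f) e≡g-f) (−-+-cancel g f)))
    (e ℤ.+ f ℤ.≟ g) (e ℤ.≟ g ℤ.- f)

mutual

  eqExps-addExps : ∀ as bs ms → eqExps (addExps as bs) ms ≡ maybe′ (eqExps as) false (ms ∸ᴱ bs)
  eqExps-addExps as       []       ms       = cong (λ cs → eqExps cs ms) (addExps-identityʳ as)
  eqExps-addExps as       (b ∷ bs) []       = begin
    eqExps (addExps as (b ∷ bs)) []           ≡⟨ eqExps-[]ʳ (addExps as (b ∷ bs)) ⟩
    isZeroExps (addExps as (b ∷ bs))          ≡⟨ isZeroExps-addExps as (b ∷ bs) ⟩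
    isZeroExps as ∧ isZeroExps (b ∷ bs)       ≡⟨ guard (isZeroExps (b ∷ bs)) ⟩
    maybe′ (eqExps as) false ([] ∸ᴱ (b ∷ bs)) ∎
    where
    open ≡.≡-Reasoning
    guard : ∀ c → isZeroExps as ∧ c ≡ maybe′ (eqExps as) false (if c then just [] else nothing)
    guard true  = ≡.trans (Boolₚ.∧-identityʳ _) (≡.sym (eqExps-[]ʳ as))
    guard false = Boolₚ.∧-zeroʳ _
  eqExps-addExps []       (b ∷ bs) (m ∷ ms) =
    ≡.trans (eqExps-addExps-∷ 0 [] b bs m ms) (≡.sym (cong-maybe′ eqExps-[]ˡ ((m ∷ ms) ∸ᴱ (b ∷ bs))))
    where
    cong-maybe′ : ∀ {f g : Exps → Bool} → (∀ d → f d ≡ g d) → ∀ x → maybe′ f false x ≡ maybe′ g false x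
    cong-maybe′ f≗g (just d) = f≗g d
    cong-maybe′ f≗g nothing  = ≡.refl
  eqExps-addExps (a ∷ as) (b ∷ bs) (m ∷ ms) = eqExps-addExps-∷ a as b bs m ms

  eqExps-addExps-∷ : ∀ a as b bs m ms → eqExps (addExps (a ∷ as) (b ∷ bs)) (m ∷ ms)
                                          ≡ maybe′ (eqExps (a ∷ as)) false ((m ∷ ms) ∸ᴱ (b ∷ bs))
  eqExps-addExps-∷ a as b bs m ms rewrite eqExps-addExps as bs ms with b ℕ.≤ᵇ m in b≤m | ms ∸ᴱ bs
  ... | true  | just d  = cong (_∧ eqExps as d) (does-+≟-when-≤ a b m (subst T (≡.sym b≤m) tt))
  ... | true  | nothing = Boolₚ.∧-zeroʳ _
  ... | false | d?      = cong (_∧ maybe′ (eqExps as) false d?) (does-+≟-when-≰ a b m b≤m)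

eqMono-mulMono : ∀ m₁ n m → eqMono (mulMono m₁ n) m ≡ maybe′ (eqMono m₁) false (divMono n m)
eqMono-mulMono (e , as) (f , bs) (g , ms) rewrite eqExps-addExps as bs ms with ms ∸ᴱ bs
... | just d  = cong (_∧ eqExps as d) (does-+≟ℤ e f g)
... | nothing = Boolₚ.∧-zeroʳ _

termCoeff : Mono → ℚ × Mono → ℚ
termCoeff m (a , n) = when (eqMono n m) a

productCoeff : Mono → ℚ × Mono → ℚ × Mono → ℚ
productCoeff m (a , n) (b , n′) = when (eqMono (mulMono n n′) m) (a ℚ.* b)

coeff-∑ₗ : ∀ p m → coeff p m ≡ ∑ₗ p (termCoeff m)
coeff-∑ₗ []            m = ≡.refl
coeff-∑ₗ ((a , n) ∷ p) m with eqMono n m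
... | true  = cong (a ℚ.+_) (coeff-∑ₗ p m)
... | false = ≡.trans (coeff-∑ₗ p m) (≡.sym (ℚₚ.+-identityˡ _))

coeff-++ : ∀ p q m → coeff (p ++ q) m ≡ coeff p m ℚ.+ coeff q m
coeff-++ p q m = begin
  coeff (p ++ q) m                                ≡⟨ coeff-∑ₗ (p ++ q) m ⟩
  ∑ₗ (p ++ q) (termCoeff m)                       ≡⟨ ∑ₗ-++ p q _ ⟩
  ∑ₗ p (termCoeff m) ℚ.+ ∑ₗ q (termCoeff m)       ≡⟨ cong₂ ℚ._+_ (coeff-∑ₗ p m) (coeff-∑ₗ q m) ⟨
  coeff p m ℚ.+ coeff q m                         ∎
  where open ≡.≡-Reasoning

coeff-· : ∀ a p m → coeff (a ·P p) m ≡ a ℚ.* coeff p m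
coeff-· a p m = begin
  coeff (a ·P p) m                                ≡⟨ coeff-∑ₗ (a ·P p) m ⟩
  ∑ₗ (a ·P p) (termCoeff m)                       ≡⟨ ∑ₗ-map _ p _ ⟩
  ∑ₗ p (λ (b , n) → when (eqMono n m) (a ℚ.* b))  ≡⟨ ∑ₗ-cong p (λ (b , n) → when-*ˡ (eqMono n m) a b) ⟩
  ∑ₗ p (λ t → a ℚ.* termCoeff m t)                ≡⟨ ∑ₗ-*ˡ p a _ ⟩
  a ℚ.* ∑ₗ p (termCoeff m)                        ≡⟨ cong (a ℚ.*_) (coeff-∑ₗ p m) ⟨
  a ℚ.* coeff p m                                 ∎
  where open ≡.≡-Reasoning

coeff-*P : ∀ p q m → coeff (p *P q) m ≡ ∑ₗ p (λ s → ∑ₗ q (productCoeff m s))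
coeff-*P p q m = ≡.trans (coeff-∑ₗ (p *P q) m)
  (≡.trans (∑ₗ-concatMap _ p _) (∑ₗ-cong p (λ s → ∑ₗ-map _ q _)))

-- Reading the coefficients of p *P q off those of p makes _*P_ respect _≈P_.
coeff-*P-divMono : ∀ p q m →
  coeff (p *P q) m ≡ ∑ₗ q (λ (b , n) → maybe′ (coeff p) 0ℚ (divMono n m) ℚ.* b)
coeff-*P-divMono p q m = begin
  coeff (p *P q) m                                  ≡⟨ coeff-*P p q m ⟩
  ∑ₗ p (λ s → ∑ₗ q (productCoeff m s))              ≡⟨ ∑ₗ-comm p q _ ⟩
  ∑ₗ q (λ t → ∑ₗ p (λ s → productCoeff m s t))      ≡⟨ ∑ₗ-cong q divide ⟩
  ∑ₗ q (λ (b , n) → maybe′ (coeff p) 0ℚ (divMono n m) ℚ.* b) ∎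
  where
  open ≡.≡-Reasoning
  sum-over-divisor : ∀ d → ∑ₗ p (λ (a , n′) → when (maybe′ (eqMono n′) false d) a) ≡ maybe′ (coeff p) 0ℚ d
  sum-over-divisor (just m′) = ≡.sym (coeff-∑ₗ p m′)
  sum-over-divisor nothing   = ∑ₗ-zero p
  divide : ∀ t → ∑ₗ p (λ s → productCoeff m s t) ≡ maybe′ (coeff p) 0ℚ (divMono (proj₂ t) m) ℚ.* proj₁ t
  divide (b , n) = begin
    ∑ₗ p (λ s → productCoeff m s (b , n))                                  ≡⟨ ∑ₗ-cong p (λ (a , n′) →
        ≡.trans (when-*ʳ (eqMono (mulMono n′ n) m) a b) (cong (λ c → when c a ℚ.* b) (eqMono-mulMono n′ n m))) ⟩
    ∑ₗ p (λ (a , n′) → when (maybe′ (eqMono n′) false (divMono n m)) a ℚ.* b) ≡⟨ ∑ₗ-*ʳ p b _ ⟩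
    ∑ₗ p (λ (a , n′) → when (maybe′ (eqMono n′) false (divMono n m)) a) ℚ.* b ≡⟨ cong (ℚ._* b) (sum-over-divisor (divMono n m)) ⟩
    maybe′ (coeff p) 0ℚ (divMono n m) ℚ.* b                                 ∎

+P-cong : ∀ {p p′ q q′} → p ≈P p′ → q ≈P q′ → p +P q ≈P p′ +P q′
+P-cong {p} {p′} {q} {q′} p≈p′ q≈q′ m =
  ≡.trans (coeff-++ p q m) (≡.trans (cong₂ ℚ._+_ (p≈p′ m) (q≈q′ m)) (≡.sym (coeff-++ p′ q′ m)))

·P-cong : ∀ a {p p′} → p ≈P p′ → a ·P p ≈P a ·P p′
·P-cong a {p} {p′} p≈p′ m =
  ≡.trans (coeff-· a p m) (≡.trans (cong (a ℚ.*_) (p≈p′ m)) (≡.sym (coeff-· a p′ m)))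

*P-congˡ : ∀ {p p′} q → p ≈P p′ → p *P q ≈P p′ *P q
*P-congˡ {p} {p′} q p≈p′ m = ≡.trans (coeff-*P-divMono p q m) (≡.trans
  (∑ₗ-cong q (λ (b , n) → cong (ℚ._* b) (cong-maybe′ (divMono n m))))
  (≡.sym (coeff-*P-divMono p′ q m)))
  where
  cong-maybe′ : ∀ d → maybe′ (coeff p) 0ℚ d ≡ maybe′ (coeff p′) 0ℚ d
  cong-maybe′ (just m′) = p≈p′ m′
  cong-maybe′ nothing   = ≡.refl

+P-assoc : ∀ p q r → (p +P q) +P r ≈P p +P (q +P r)
+P-assoc p q r m = ≡.cong (λ s → coeff s m) (Listₚ.++-assoc p q r)

+P-comm : ∀ p q → p +P q ≈P q +P p
+P-comm p q m = ≡.trans (coeff-++ p q m)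
  (≡.trans (ℚₚ.+-comm (coeff p m) (coeff q m)) (≡.sym (coeff-++ q p m)))

+P-identityʳ : ∀ p → p +P 0P ≈P p
+P-identityʳ p m = cong (λ s → coeff s m) (Listₚ.++-identityʳ p)

-P-inverseʳ : ∀ p → p +P -P p ≈P 0P
-P-inverseʳ p m = begin
  coeff (p +P -P p) m                ≡⟨ coeff-++ p (-P p) m ⟩
  coeff p m ℚ.+ coeff (-P p) m       ≡⟨ cong (coeff p m ℚ.+_) (coeff-· (ℚ.- 1ℚ) p m) ⟩
  coeff p m ℚ.+ ℚ.- 1ℚ ℚ.* coeff p m ≡⟨ x-x≡0 (coeff p m) ⟩
  0ℚ                                 ∎
  where
  open ≡.≡-Reasoning
  open +-*-Solver
  x-x≡0 : ∀ x → x ℚ.+ ℚ.- 1ℚ ℚ.* x ≡ 0ℚ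
  x-x≡0 = solve 1 (λ x → x :+ con (ℚ.- 1ℚ) :* x := con 0ℚ) ≡.refl

*P-comm : ∀ p q → p *P q ≈P q *P p
*P-comm p q m = begin
  coeff (p *P q) m                                ≡⟨ coeff-*P p q m ⟩
  ∑ₗ p (λ s → ∑ₗ q (productCoeff m s))            ≡⟨ ∑ₗ-comm p q _ ⟩
  ∑ₗ q (λ t → ∑ₗ p (λ s → productCoeff m s t))    ≡⟨ ∑ₗ-cong q (λ t → ∑ₗ-cong p (λ s → swap s t)) ⟩
  ∑ₗ q (λ t → ∑ₗ p (productCoeff m t))            ≡⟨ coeff-*P q p m ⟨
  coeff (q *P p) m                                ∎
  where
  open ≡.≡-Reasoning
  swap : ∀ s t → productCoeff m s t ≡ productCoeff m t s
  swap (a , n) (b , n′) = cong₂ (λ k c → when (eqMono k m) c) (mulMono-comm n n′) (ℚₚ.*-comm a b)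

*P-assoc : ∀ p q r → (p *P q) *P r ≈P p *P (q *P r)
*P-assoc p q r m = begin
  coeff ((p *P q) *P r) m                                             ≡⟨ coeff-*P (p *P q) r m ⟩
  ∑ₗ (p *P q) (λ s → ∑ₗ r (productCoeff m s))                         ≡⟨ ∑ₗ-concatMap _ p _ ⟩
  ∑ₗ p (λ s → ∑ₗ (map _ q) (λ st → ∑ₗ r (productCoeff m st)))         ≡⟨ ∑ₗ-cong p (λ s → ∑ₗ-map _ q _) ⟩
  ∑ₗ p (λ s → ∑ₗ q (λ t → ∑ₗ r (productCoeff m (mulTerm s t))))       ≡⟨ ∑ₗ-cong p (λ s → ∑ₗ-cong q (λ t →
                                                                           ≡.trans (∑ₗ-cong r (reassoc s t)) (≡.sym (∑ₗ-map _ r _)))) ⟩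
  ∑ₗ p (λ s → ∑ₗ q (λ t → ∑ₗ (map _ r) (productCoeff m s)))           ≡⟨ ∑ₗ-cong p (λ s → ∑ₗ-concatMap _ q _) ⟨
  ∑ₗ p (λ s → ∑ₗ (q *P r) (productCoeff m s))                         ≡⟨ coeff-*P p (q *P r) m ⟨
  coeff (p *P (q *P r)) m                                             ∎
  where
  open ≡.≡-Reasoning
  mulTerm : ℚ × Mono → ℚ × Mono → ℚ × Mono
  mulTerm (a , n) (b , n′) = (a ℚ.* b , mulMono n n′)
  reassoc : ∀ s t u → productCoeff m (mulTerm s t) u ≡ productCoeff m s (mulTerm t u)
  reassoc (a , n) (b , n′) (c , n″) =
    cong₂ (λ k d → when (eqMono k m) d) (mulMono-assoc n n′ n″) (ℚₚ.*-assoc a b c)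

*P-identityˡ : ∀ p → 1P *P p ≈P p
*P-identityˡ p m = begin
  coeff (1P *P p) m                                      ≡⟨ coeff-*P 1P p m ⟩
  ∑ₗ p (productCoeff m (1ℚ , (+ 0 , []))) ℚ.+ 0ℚ         ≡⟨ ℚₚ.+-identityʳ _ ⟩
  ∑ₗ p (productCoeff m (1ℚ , (+ 0 , [])))                ≡⟨ ∑ₗ-cong p (λ (b , n) →
                  cong₂ (λ k c → when (eqMono k m) c) (mulMono-identityˡ n) (ℚₚ.*-identityˡ b)) ⟩
  ∑ₗ p (termCoeff m)                                     ≡⟨ coeff-∑ₗ p m ⟨
  coeff p m                                              ∎
  where open ≡.≡-Reasoning

*P-distribʳ : ∀ p q r → (q +P r) *P p ≈P q *P p +P r *P p
*P-distribʳ p q r m = begin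
  coeff ((q +P r) *P p) m                                         ≡⟨ coeff-*P (q ++ r) p m ⟩
  ∑ₗ (q ++ r) (λ s → ∑ₗ p (productCoeff m s))                     ≡⟨ ∑ₗ-++ q r _ ⟩
  ∑ₗ q (λ s → ∑ₗ p (productCoeff m s)) ℚ.+ ∑ₗ r (λ s → ∑ₗ p (productCoeff m s)) ≡⟨ cong₂ ℚ._+_ (coeff-*P q p m) (coeff-*P r p m) ⟨
  coeff (q *P p) m ℚ.+ coeff (r *P p) m                           ≡⟨ coeff-++ (q *P p) (r *P p) m ⟨
  coeff (q *P p +P r *P p) m                                      ∎
  where open ≡.≡-Reasoning

infix 4 _≃_
record _≃_ (p q : Poly) : Set where
  constructor coeffwise
  field coeff≡ : p ≈P q
open _≃_

PolyRing : CommutativeRing 0ℓ 0ℓ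
PolyRing = record
  { Carrier = Poly ; _≈_ = _≃_ ; _+_ = _+P_ ; _*_ = _*P_ ; -_ = -P_ ; 0# = 0P ; 1# = 1P
  ; isCommutativeRing = record
    { isRing = record
      { +-isAbelianGroup = record
        { isGroup = record
          { isMonoid = record
            { isSemigroup = record
              { isMagma = record
                { isEquivalence = record
                  { refl  = coeffwise (λ _ → ≡.refl)
                  ; sym   = λ p≃q → coeffwise (λ m → ≡.sym (coeff≡ p≃q m))
                  ; trans = λ p≃q q≃r → coeffwise (λ m → ≡.trans (coeff≡ p≃q m) (coeff≡ q≃r m)) }
                ; ∙-cong = λ {p} {p′} {q} {q′} p≃p′ q≃q′ → coeffwise (+P-cong {p} {p′} {q} {q′} (coeff≡ p≃p′) (coeff≡ q≃q′)) }
              ; assoc = λ p q r → coeffwise (+P-assoc p q r) }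
            ; identity = (λ p → coeffwise (λ _ → ≡.refl)) , (λ p → coeffwise (+P-identityʳ p)) }
          ; inverse = (λ p → coeffwise (λ m → ≡.trans (+P-comm (-P p) p m) (-P-inverseʳ p m)))
                    , (λ p → coeffwise (-P-inverseʳ p))
          ; ⁻¹-cong = λ {p} {p′} p≃p′ → coeffwise (·P-cong (ℚ.- 1ℚ) {p} {p′} (coeff≡ p≃p′)) }
        ; comm = λ p q → coeffwise (+P-comm p q) }
      ; *-cong = λ {p} {p′} {q} {q′} p≃p′ q≃q′ → coeffwise (λ m →
          ≡.trans (*P-congˡ {p} {p′} q (coeff≡ p≃p′) m) (≡.trans (*P-comm p′ q m)
          (≡.trans (*P-congˡ {q} {q′} p′ (coeff≡ q≃q′) m) (*P-comm q′ p′ m))))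
      ; *-assoc = λ p q r → coeffwise (*P-assoc p q r)
      ; *-identity = (λ p → coeffwise (*P-identityˡ p))
                   , (λ p → coeffwise (λ m → ≡.trans (*P-comm p 1P m) (*P-identityˡ p m)))
      ; distrib = (λ p q r → coeffwise (λ m → ≡.trans (*P-comm p (q +P r) m) (≡.trans (*P-distribʳ p q r m)
                     (+P-cong {q *P p} {p *P q} {r *P p} {p *P r} (*P-comm q p) (*P-comm r p) m))))
                , (λ p q r → coeffwise (*P-distribʳ p q r)) }
    ; *-comm = λ p q → coeffwise (*P-comm p q) } }

record ℚAlgebra : Set₁ where
  field
    commutativeRing : CommutativeRing 0ℓ 0ℓ
  open CommutativeRing commutativeRing public
  field
    ι     : ℚ → Carrier
    ι-+   : ∀ a b → ι (a ℚ.+ b) ≈ ι a + ι b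
    ι-*   : ∀ a b → ι (a ℚ.* b) ≈ ι a * ι b
    ι-neg : ∀ a → ι (ℚ.- a) ≈ - ι a
    ι-0   : ι 0ℚ ≈ 0#
    ι-1   : ι 1ℚ ≈ 1#

module ℚAlgebraSolver (A : ℚAlgebra) where
  open ℚAlgebra A
  import Algebra.Solver.Ring.AlmostCommutativeRing as ACR

  private
    ℚ-rawRing : RawRing 0ℓ 0ℓ
    ℚ-rawRing = record { Carrier = ℚ ; _≈_ = _≡_ ; _+_ = ℚ._+_ ; _*_ = ℚ._*_ ; -_ = ℚ.-_ ; 0# = 0ℚ ; 1# = 1ℚ }

    ι-morphism : ℚ-rawRing ACR.-Raw-AlmostCommutative⟶ ACR.fromCommutativeRing commutativeRing
    ι-morphism = record { ⟦_⟧ = ι ; +-homo = ι-+ ; *-homo = ι-* ; -‿homo = ι-neg ; 0-homo = ι-0 ; 1-homo = ι-1 }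

    ι-≟ : ∀ a b → Maybe (ι a ≈ ι b)
    ι-≟ a b with a ℚ.≟ b
    ... | yes ≡.refl = just refl
    ... | no _     = nothing

  open import Algebra.Solver.Ring ℚ-rawRing (ACR.fromCommutativeRing commutativeRing) ι-morphism ι-≟ public

private
  coeff-constP : ∀ a m → coeff (constP a) m ≡ when (eqMono (+ 0 , []) m) a
  coeff-constP a m with eqMono (+ 0 , []) m
  ... | true  = ℚₚ.+-identityʳ a
  ... | false = ≡.refl

  constP-+ : ∀ a b → constP (a ℚ.+ b) ≈P constP a +P constP b
  constP-+ a b m = begin
    coeff (constP (a ℚ.+ b)) m              ≡⟨ coeff-constP (a ℚ.+ b) m ⟩
    when c (a ℚ.+ b)                        ≡⟨ when-+ c ⟩
    when c a ℚ.+ when c b                   ≡⟨ cong₂ ℚ._+_ (coeff-constP a m) (coeff-constP b m) ⟨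
    coeff (constP a) m ℚ.+ coeff (constP b) m ≡⟨ coeff-++ (constP a) (constP b) m ⟨
    coeff (constP a +P constP b) m          ∎
    where
    open ≡.≡-Reasoning
    c : Bool
    c = eqMono (+ 0 , []) m
    when-+ : ∀ c → when c (a ℚ.+ b) ≡ when c a ℚ.+ when c b
    when-+ true  = ≡.refl
    when-+ false = ≡.refl

  constP-* : ∀ a b → constP (a ℚ.* b) ≈P constP a *P constP b
  constP-* a b m = ≡.trans (coeff-constP (a ℚ.* b) m)
    (≡.sym (≡.trans (coeff-*P (constP a) (constP b) m) (≡.trans (ℚₚ.+-identityʳ _) (ℚₚ.+-identityʳ _))))

  constP-neg : ∀ a → constP (ℚ.- a) ≈P -P constP a
  constP-neg a m = begin
    coeff (constP (ℚ.- a)) m              ≡⟨ coeff-constP (ℚ.- a) m ⟩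
    when c (ℚ.- a)                        ≡⟨ cong (when c) (≡.trans (cong ℚ.-_ (≡.sym (ℚₚ.*-identityˡ a))) (ℚₚ.neg-distribˡ-* 1ℚ a)) ⟩
    when c (ℚ.- 1ℚ ℚ.* a)                 ≡⟨ when-*ˡ c (ℚ.- 1ℚ) a ⟩
    ℚ.- 1ℚ ℚ.* when c a                   ≡⟨ cong (ℚ.- 1ℚ ℚ.*_) (coeff-constP a m) ⟨
    ℚ.- 1ℚ ℚ.* coeff (constP a) m         ≡⟨ coeff-· (ℚ.- 1ℚ) (constP a) m ⟨
    coeff (-P constP a) m                 ∎
    where
    open ≡.≡-Reasoning
    c : Bool
    c = eqMono (+ 0 , []) m

  constP-0 : constP 0ℚ ≈P 0P
  constP-0 m = ≡.trans (coeff-constP 0ℚ m) (when-0 (eqMono (+ 0 , []) m))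
    where
    when-0 : ∀ c → when c 0ℚ ≡ 0ℚ
    when-0 true  = ≡.refl
    when-0 false = ≡.refl

PolyAlgebra : ℚAlgebra
PolyAlgebra = record
  { commutativeRing = PolyRing
  ; ι     = constP
  ; ι-+   = λ a b → coeffwise (constP-+ a b)
  ; ι-*   = λ a b → coeffwise (constP-* a b)
  ; ι-neg = λ a → coeffwise (constP-neg a)
  ; ι-0   = coeffwise constP-0
  ; ι-1   = coeffwise (λ _ → ≡.refl)
  }

map-applyUpTo : ∀ {A B : Set} (h : A → B) (f : ℕ → A) n → map h (applyUpTo f n) ≡ applyUpTo (h ∘ f) n
map-applyUpTo h f zero    = ≡.refl
map-applyUpTo h f (suc n) = cong (h (f 0) ∷_) (map-applyUpTo h (f ∘ suc) n)

module PowerSeries (A : ℚAlgebra) where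
  open ℚAlgebra A
  open ℚAlgebraSolver A using (solve; _:=_; _:+_; _:*_)
  open import Relation.Binary.Reasoning.Setoid setoid

  Series : Set
  Series = ℕ → Carrier

  infixl 6 _⊕_
  infixl 7 _⊛_ _⊙_
  infix  8 ⊝_

  -- written exactly as _*S_ in Defs, so that for polynomial coefficients the two agree definitionally
  _⊛_ : Series → Series → Series
  (f ⊛ g) n = foldr _+_ 0# (map (λ i → f i * g (n ∸ i)) (upTo (suc n)))

  _⊕_ : Series → Series → Series
  (f ⊕ g) n = f n + g n

  ⊝_ : Series → Series
  (⊝ f) n = - f n

  _⊙_ : Carrier → Series → Series
  (c ⊙ f) n = c * f n

  𝟘 : Series
  𝟘 n = 0#

  const : Carrier → Series
  const c zero    = c
  const c (suc n) = 0#

  𝟙 : Series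
  𝟙 = const 1#

  tail : Series → Series
  tail f n = f (suc n)

  ⊛-zero : ∀ f g → (f ⊛ g) 0 ≈ f 0 * g 0
  ⊛-zero f g = +-identityʳ _

  ⊛-suc : ∀ f g n → (f ⊛ g) (suc n) ≡ f 0 * g (suc n) + (tail f ⊛ g) n
  ⊛-suc f g n = cong (λ l → f 0 * g (suc n) + foldr _+_ 0# l)
    (≡.trans (map-applyUpTo (λ i → f i * g (suc n ∸ i)) suc (suc n))
             (≡.sym (map-applyUpTo (λ i → f (suc i) * g (n ∸ i)) id (suc n))))

  ≡⇒≈ : ∀ {x y} → x ≡ y → x ≈ y
  ≡⇒≈ ≡.refl = refl

  ⊛-cong : ∀ {f f′ g g′} n → (∀ i → i ≤ n → f i ≈ f′ i) → (∀ i → i ≤ n → g i ≈ g′ i) →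
           (f ⊛ g) n ≈ (f′ ⊛ g′) n
  ⊛-cong {f} {f′} {g} {g′} zero f≈f′ g≈g′ = begin
    (f ⊛ g) 0       ≈⟨ ⊛-zero f g ⟩
    f 0 * g 0       ≈⟨ *-cong (f≈f′ 0 z≤n) (g≈g′ 0 z≤n) ⟩
    f′ 0 * g′ 0     ≈⟨ ⊛-zero f′ g′ ⟨
    (f′ ⊛ g′) 0     ∎
  ⊛-cong {f} {f′} {g} {g′} (suc n) f≈f′ g≈g′ = begin
    (f ⊛ g) (suc n)                      ≈⟨ ≡⇒≈ (⊛-suc f g n) ⟩
    f 0 * g (suc n) + (tail f ⊛ g) n     ≈⟨ +-cong (*-cong (f≈f′ 0 z≤n) (g≈g′ (suc n) ℕₚ.≤-refl))
                                              (⊛-cong n (λ i i≤n → f≈f′ (suc i) (s≤s i≤n))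
                                                        (λ i i≤n → g≈g′ i (ℕₚ.m≤n⇒m≤1+n i≤n))) ⟩
    f′ 0 * g′ (suc n) + (tail f′ ⊛ g′) n ≈⟨ ≡⇒≈ (⊛-suc f′ g′ n) ⟨
    (f′ ⊛ g′) (suc n)                    ∎

  ⊛-zeroˡ : ∀ g n → (𝟘 ⊛ g) n ≈ 0#
  ⊛-zeroˡ g zero    = trans (⊛-zero 𝟘 g) (zeroˡ _)
  ⊛-zeroˡ g (suc n) = trans (≡⇒≈ (⊛-suc 𝟘 g n)) (trans (+-cong (zeroˡ _) (⊛-zeroˡ g n)) (+-identityʳ _))

  ⊛-identityˡ : ∀ g n → (𝟙 ⊛ g) n ≈ g n
  ⊛-identityˡ g zero    = trans (⊛-zero 𝟙 g) (*-identityˡ _)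
  ⊛-identityˡ g (suc n) = trans (≡⇒≈ (⊛-suc 𝟙 g n)) (trans (+-cong (*-identityˡ _) (⊛-zeroˡ g n)) (+-identityʳ _))

  const-⊛ : ∀ c g n → (const c ⊛ g) n ≈ c * g n
  const-⊛ c g zero    = ⊛-zero (const c) g
  const-⊛ c g (suc n) = trans (≡⇒≈ (⊛-suc (const c) g n)) (trans (+-cong refl (⊛-zeroˡ g n)) (+-identityʳ _))

  ⊙-⊛ : ∀ c f g n → ((c ⊙ f) ⊛ g) n ≈ c * (f ⊛ g) n
  ⊙-⊛ c f g zero = trans (⊛-zero (c ⊙ f) g) (trans (*-assoc _ _ _) (*-cong refl (sym (⊛-zero f g))))
  ⊙-⊛ c f g (suc n) = begin
    ((c ⊙ f) ⊛ g) (suc n)                          ≈⟨ ≡⇒≈ (⊛-suc (c ⊙ f) g n) ⟩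
    c * f 0 * g (suc n) + ((c ⊙ tail f) ⊛ g) n     ≈⟨ +-cong refl (⊙-⊛ c (tail f) g n) ⟩
    c * f 0 * g (suc n) + c * (tail f ⊛ g) n       ≈⟨ solve 4 (λ c a b d → c :* a :* b :+ c :* d := c :* (a :* b :+ d))
                                                            refl c (f 0) (g (suc n)) ((tail f ⊛ g) n) ⟩
    c * (f 0 * g (suc n) + (tail f ⊛ g) n)         ≈⟨ *-cong refl (≡⇒≈ (⊛-suc f g n)) ⟨
    c * (f ⊛ g) (suc n)                            ∎

  ⊛-distribʳ : ∀ f f′ g n → ((f ⊕ f′) ⊛ g) n ≈ (f ⊛ g) n + (f′ ⊛ g) n
  ⊛-distribʳ f f′ g zero =
    trans (⊛-zero (f ⊕ f′) g) (trans (distribʳ _ _ _) (sym (+-cong (⊛-zero f g) (⊛-zero f′ g))))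
  ⊛-distribʳ f f′ g (suc n) = begin
    ((f ⊕ f′) ⊛ g) (suc n)                                      ≈⟨ ≡⇒≈ (⊛-suc (f ⊕ f′) g n) ⟩
    (f 0 + f′ 0) * g (suc n) + ((tail f ⊕ tail f′) ⊛ g) n       ≈⟨ +-cong refl (⊛-distribʳ (tail f) (tail f′) g n) ⟩
    (f 0 + f′ 0) * g (suc n) + ((tail f ⊛ g) n + (tail f′ ⊛ g) n)
      ≈⟨ solve 5 (λ a b c d e → (a :+ b) :* c :+ (d :+ e) := (a :* c :+ d) :+ (b :* c :+ e))
                 refl (f 0) (f′ 0) (g (suc n)) _ _ ⟩
    (f 0 * g (suc n) + (tail f ⊛ g) n) + (f′ 0 * g (suc n) + (tail f′ ⊛ g) n)
      ≈⟨ ≡⇒≈ (cong₂ _+_ (⊛-suc f g n) (⊛-suc f′ g n)) ⟨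
    (f ⊛ g) (suc n) + (f′ ⊛ g) (suc n)                          ∎

  ⊛-comm : ∀ f g n → (f ⊛ g) n ≈ (g ⊛ f) n
  ⊛-comm f g zero = trans (⊛-zero f g) (trans (*-comm _ _) (sym (⊛-zero g f)))
  ⊛-comm f g (suc zero) = begin
    (f ⊛ g) 1                  ≈⟨ ≡⇒≈ (⊛-suc f g 0) ⟩
    f 0 * g 1 + (tail f ⊛ g) 0 ≈⟨ +-cong refl (⊛-zero (tail f) g) ⟩
    f 0 * g 1 + f 1 * g 0      ≈⟨ solve 4 (λ a b c d → a :* b :+ c :* d := d :* c :+ b :* a) refl (f 0) (g 1) (f 1) (g 0) ⟩
    g 0 * f 1 + g 1 * f 0      ≈⟨ +-cong refl (⊛-zero (tail g) f) ⟨
    g 0 * f 1 + (tail g ⊛ f) 0 ≈⟨ ≡⇒≈ (⊛-suc g f 0) ⟨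
    (g ⊛ f) 1                  ∎
  ⊛-comm f g (suc (suc n)) = begin
    (f ⊛ g) (2+n)                                  ≈⟨ ≡⇒≈ (⊛-suc f g (suc n)) ⟩
    f 0 * g (2+n) + (tail f ⊛ g) (suc n)           ≈⟨ +-cong refl (⊛-comm (tail f) g (suc n)) ⟩
    f 0 * g (2+n) + (g ⊛ tail f) (suc n)           ≈⟨ +-cong refl (≡⇒≈ (⊛-suc g (tail f) n)) ⟩
    f 0 * g (2+n) + (g 0 * f (2+n) + (tail g ⊛ tail f) n)
                                                   ≈⟨ +-cong refl (+-cong refl (⊛-comm (tail g) (tail f) n)) ⟩
    f 0 * g (2+n) + (g 0 * f (2+n) + (tail f ⊛ tail g) n)
      ≈⟨ solve 5 (λ a b c d e → a :* b :+ (c :* d :+ e) := c :* d :+ (a :* b :+ e)) refl (f 0) (g (2+n)) (g 0) (f (2+n)) _ ⟩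
    g 0 * f (2+n) + (f 0 * g (2+n) + (tail f ⊛ tail g) n)
                                                   ≈⟨ +-cong refl (≡⇒≈ (⊛-suc f (tail g) n)) ⟨
    g 0 * f (2+n) + (f ⊛ tail g) (suc n)           ≈⟨ +-cong refl (⊛-comm f (tail g) (suc n)) ⟩
    g 0 * f (2+n) + (tail g ⊛ f) (suc n)           ≈⟨ ≡⇒≈ (⊛-suc g f (suc n)) ⟨
    (g ⊛ f) (2+n)                                  ∎
    where
    2+n : ℕ
    2+n = suc (suc n)

  ⊛-assoc : ∀ f g h n → ((f ⊛ g) ⊛ h) n ≈ (f ⊛ (g ⊛ h)) n
  ⊛-assoc f g h zero = begin
    ((f ⊛ g) ⊛ h) 0   ≈⟨ ⊛-zero (f ⊛ g) h ⟩
    (f ⊛ g) 0 * h 0   ≈⟨ *-cong (⊛-zero f g) refl ⟩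
    f 0 * g 0 * h 0   ≈⟨ *-assoc _ _ _ ⟩
    f 0 * (g 0 * h 0) ≈⟨ *-cong refl (⊛-zero g h) ⟨
    f 0 * (g ⊛ h) 0   ≈⟨ ⊛-zero f (g ⊛ h) ⟨
    (f ⊛ (g ⊛ h)) 0   ∎
  ⊛-assoc f g h (suc n) = begin
    ((f ⊛ g) ⊛ h) (suc n)                                   ≈⟨ ≡⇒≈ (⊛-suc (f ⊛ g) h n) ⟩
    (f ⊛ g) 0 * h (suc n) + (tail (f ⊛ g) ⊛ h) n            ≈⟨ +-cong (*-cong (⊛-zero f g) refl)
                                                                 (⊛-cong {g = h} {g′ = h} n (λ i _ → ≡⇒≈ (⊛-suc f g i)) (λ i _ → refl)) ⟩
    f 0 * g 0 * h (suc n) + ((f 0 ⊙ tail g ⊕ tail f ⊛ g) ⊛ h) n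
                                                            ≈⟨ +-cong refl (⊛-distribʳ _ _ h n) ⟩
    f 0 * g 0 * h (suc n) + (((f 0 ⊙ tail g) ⊛ h) n + ((tail f ⊛ g) ⊛ h) n)
                                                            ≈⟨ +-cong refl (+-cong (⊙-⊛ (f 0) (tail g) h n) (⊛-assoc (tail f) g h n)) ⟩
    f 0 * g 0 * h (suc n) + (f 0 * (tail g ⊛ h) n + (tail f ⊛ (g ⊛ h)) n)
      ≈⟨ solve 5 (λ a b c d e → a :* b :* c :+ (a :* d :+ e) := a :* (b :* c :+ d) :+ e) refl (f 0) (g 0) (h (suc n)) _ _ ⟩
    f 0 * (g 0 * h (suc n) + (tail g ⊛ h) n) + (tail f ⊛ (g ⊛ h)) n
                                                            ≈⟨ +-cong (*-cong refl (≡⇒≈ (⊛-suc g h n))) refl ⟨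
    f 0 * (g ⊛ h) (suc n) + (tail f ⊛ (g ⊛ h)) n            ≈⟨ ≡⇒≈ (⊛-suc f (g ⊛ h) n) ⟨
    (f ⊛ (g ⊛ h)) (suc n)                                   ∎


  shift : Series → Series
  shift f zero    = 0#
  shift f (suc n) = f n

  Y : Series
  Y = shift 𝟙

  Y-⊛ : ∀ f n → (Y ⊛ f) n ≈ shift f n
  Y-⊛ f zero    = trans (⊛-zero Y f) (zeroˡ _)
  Y-⊛ f (suc n) = begin
    (Y ⊛ f) (suc n)                 ≈⟨ ≡⇒≈ (⊛-suc Y f n) ⟩
    0# * f (suc n) + (𝟙 ⊛ f) n      ≈⟨ +-cong (zeroˡ _) (⊛-identityˡ f n) ⟩
    0# + f n                        ≈⟨ +-identityˡ _ ⟩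
    f n                             ∎

  ⊛-vanishʳ : ∀ f g n → (∀ i → i ≤ n → g i ≈ 0#) → (f ⊛ g) n ≈ 0#
  ⊛-vanishʳ f g n g≈0 = trans (⊛-comm f g n) (trans (⊛-cong {g} {𝟘} {f} {f} n g≈0 (λ i _ → refl)) (⊛-zeroˡ f n))

  ⊛-leading : ∀ f g i → (∀ j → j < i → f j ≈ 0#) → (f ⊛ g) i ≈ f i * g 0
  ⊛-leading f g zero    _    = ⊛-zero f g
  ⊛-leading f g (suc i) f≈0 = begin
    (f ⊛ g) (suc i)                         ≈⟨ ≡⇒≈ (⊛-suc f g i) ⟩
    f 0 * g (suc i) + (tail f ⊛ g) i        ≈⟨ +-cong (trans (*-cong (f≈0 0 (s≤s z≤n)) refl) (zeroˡ _))
                                                 (⊛-leading (tail f) g i (λ j j<i → f≈0 (suc j) (s≤s j<i))) ⟩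
    0# + f (suc i) * g 0                    ≈⟨ +-identityˡ _ ⟩
    f (suc i) * g 0                         ∎

  module _ {h : Carrier → Carrier} (h-hom : RingMorphisms.IsRingHomomorphism rawRing rawRing h) where
    open RingMorphisms.IsRingHomomorphism h-hom

    map-⊛ : ∀ f g n → h ((f ⊛ g) n) ≈ ((h ∘ f) ⊛ (h ∘ g)) n
    map-⊛ f g zero = trans (+-homo _ _) (+-cong (*-homo (f 0) (g 0)) 0#-homo)
    map-⊛ f g (suc n) = begin
      h ((f ⊛ g) (suc n))                            ≡⟨ cong h (⊛-suc f g n) ⟩
      h (f 0 * g (suc n) + (tail f ⊛ g) n)           ≈⟨ +-homo _ _ ⟩
      h (f 0 * g (suc n)) + h ((tail f ⊛ g) n)       ≈⟨ +-cong (*-homo _ _) (map-⊛ (tail f) g n) ⟩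
      h (f 0) * h (g (suc n)) + ((h ∘ tail f) ⊛ (h ∘ g)) n ≈⟨ ≡⇒≈ (⊛-suc (h ∘ f) (h ∘ g) n) ⟨
      ((h ∘ f) ⊛ (h ∘ g)) (suc n)                    ∎

    map-const : ∀ c n → h (const c n) ≈ const (h c) n
    map-const c zero    = refl
    map-const c (suc n) = 0#-homo

  module Truncated (N : ℕ) where

    infix 4 _≋_
    record _≋_ (f g : Series) : Set where
      constructor agree
      field agree-at : ∀ i → i ≤ N → f i ≈ g i
    open _≋_ public

    pointwise : ∀ {f g} → (∀ i → f i ≈ g i) → f ≋ g
    pointwise f≈g = agree (λ i _ → f≈g i)

    TruncatedRing : CommutativeRing 0ℓ 0ℓ
    TruncatedRing = record
      { Carrier = Series ; _≈_ = _≋_ ; _+_ = _⊕_ ; _*_ = _⊛_ ; -_ = ⊝_ ; 0# = 𝟘 ; 1# = 𝟙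
      ; isCommutativeRing = record
        { isRing = record
          { +-isAbelianGroup = record
            { isGroup = record
              { isMonoid = record
                { isSemigroup = record
                  { isMagma = record
                    { isEquivalence = record
                      { refl  = pointwise (λ _ → refl)
                      ; sym   = λ f≋g → agree (λ i i≤N → sym (agree-at f≋g i i≤N))
                      ; trans = λ f≋g g≋h → agree (λ i i≤N → trans (agree-at f≋g i i≤N) (agree-at g≋h i i≤N)) }
                    ; ∙-cong = λ f≋f′ g≋g′ → agree (λ i i≤N → +-cong (agree-at f≋f′ i i≤N) (agree-at g≋g′ i i≤N)) }
                  ; assoc = λ f g h → pointwise (λ _ → +-assoc _ _ _) }
                ; identity = (λ f → pointwise (λ _ → +-identityˡ _)) , (λ f → pointwise (λ _ → +-identityʳ _)) }
              ; inverse = (λ f → pointwise (λ _ → -‿inverseˡ _)) , (λ f → pointwise (λ _ → -‿inverseʳ _))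
              ; ⁻¹-cong = λ f≋f′ → agree (λ i i≤N → -‿cong (agree-at f≋f′ i i≤N)) }
            ; comm = λ f g → pointwise (λ _ → +-comm _ _) }
          ; *-cong = λ f≋f′ g≋g′ → agree (λ i i≤N →
              ⊛-cong i (λ j j≤i → agree-at f≋f′ j (ℕₚ.≤-trans j≤i i≤N)) (λ j j≤i → agree-at g≋g′ j (ℕₚ.≤-trans j≤i i≤N)))
          ; *-assoc = λ f g h → pointwise (⊛-assoc f g h)
          ; *-identity = (λ f → pointwise (⊛-identityˡ f)) , (λ f → pointwise (λ i → trans (⊛-comm f 𝟙 i) (⊛-identityˡ f i)))
          ; distrib = (λ h f g → pointwise (λ i → trans (⊛-comm h (f ⊕ g) i)
                                   (trans (⊛-distribʳ f g h i) (+-cong (⊛-comm f h i) (⊛-comm g h i)))))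
                    , (λ h f g → pointwise (⊛-distribʳ f g h)) }
        ; *-comm = λ f g → pointwise (⊛-comm f g) } }

    open import Algebra.Properties.CommutativeSemiring.Exp (CommutativeRing.commutativeSemiring TruncatedRing) public
      using (_^_)

    ^-vanish : ∀ f → f 0 ≈ 0# → ∀ k n → n < k → (f ^ k) n ≈ 0#
    ^-vanish f f₀≈0 (suc k) zero    _         =
      trans (⊛-zero f (f ^ k)) (trans (*-cong f₀≈0 refl) (zeroˡ _))
    ^-vanish f f₀≈0 (suc k) (suc n) (s≤s n<k) = begin
      (f ^ suc k) (suc n)                      ≈⟨ ≡⇒≈ (⊛-suc f (f ^ k) n) ⟩
      f 0 * (f ^ k) (suc n) + (tail f ⊛ f ^ k) n
        ≈⟨ +-cong (trans (*-cong f₀≈0 refl) (zeroˡ _))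
                  (⊛-vanishʳ (tail f) (f ^ k) n (λ i i≤n → ^-vanish f f₀≈0 k i (ℕₚ.≤-<-trans i≤n n<k))) ⟩
      0# + 0#                                  ≈⟨ +-identityʳ _ ⟩
      0#                                       ∎

    private
      open import Algebra.Properties.Ring ring using (-0#≈0#)

      const-ι-* : ∀ a b i → const (ι (a ℚ.* b)) i ≈ (const (ι a) ⊛ const (ι b)) i
      const-ι-* a b zero    = trans (ι-* a b) (sym (const-⊛ (ι a) (const (ι b)) 0))
      const-ι-* a b (suc i) = sym (trans (const-⊛ (ι a) (const (ι b)) (suc i)) (zeroʳ _))

    TruncatedAlgebra : ℚAlgebra
    TruncatedAlgebra = record
      { commutativeRing = TruncatedRing
      ; ι     = const ∘ ι
      ; ι-+   = λ a b → pointwise (λ { zero → ι-+ a b ; (suc i) → sym (+-identityʳ _) })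
      ; ι-*   = λ a b → pointwise (const-ι-* a b)
      ; ι-neg = λ a → pointwise (λ { zero → ι-neg a ; (suc i) → sym -0#≈0# })
      ; ι-0   = pointwise (λ { zero → ι-0 ; (suc i) → refl })
      ; ι-1   = pointwise (λ { zero → ι-1 ; (suc i) → refl })
      }

    cancelˡ : ∀ {d f} → (∀ a → d 0 * a ≈ 0# → a ≈ 0#) → d ⊛ f ≋ 𝟘 → f ≋ 𝟘
    cancelˡ {d} {f} d₀-cancel d⊛f≋0 = agree (λ i i≤N → vanish (suc i) (s≤s i≤N) i ℕₚ.≤-refl)
      where
      vanish : ∀ i → i ≤ suc N → ∀ j → j < i → f j ≈ 0#
      vanish (suc i) (s≤s i≤N) j (s≤s j≤i) with ℕₚ.m≤n⇒m<n∨m≡n j≤i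
      ... | inj₁ j<i    = vanish i (ℕₚ.m≤n⇒m≤1+n i≤N) j j<i
      ... | inj₂ ≡.refl = d₀-cancel (f j) (begin
        d 0 * f j     ≈⟨ *-comm _ _ ⟩
        f j * d 0     ≈⟨ ⊛-leading f d j (vanish j (ℕₚ.m≤n⇒m≤1+n i≤N)) ⟨
        (f ⊛ d) j     ≈⟨ ⊛-comm f d j ⟩
        (d ⊛ f) j     ≈⟨ agree-at d⊛f≋0 j i≤N ⟩
        0#            ∎)

    Y²-factor : ∀ {f} → Y ⊛ Y ⊛ f ≋ 𝟘 → ∀ i → 2 ℕ.+ i ≤ N → f i ≈ 0#
    Y²-factor {f} Y²f≋0 i 2+i≤N = begin
      f i                          ≈⟨ Y-⊛ f (suc i) ⟨
      (Y ⊛ f) (suc i)              ≈⟨ Y-⊛ (Y ⊛ f) (2 ℕ.+ i) ⟨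
      (Y ⊛ (Y ⊛ f)) (2 ℕ.+ i)      ≈⟨ ⊛-assoc Y Y f (2 ℕ.+ i) ⟨
      (Y ⊛ Y ⊛ f) (2 ℕ.+ i)        ≈⟨ agree-at Y²f≋0 (2 ℕ.+ i) 2+i≤N ⟩
      0#                           ∎

    map-isRingHomomorphism : ∀ {h} → RingMorphisms.IsRingHomomorphism rawRing rawRing h →
      RingMorphisms.IsRingHomomorphism (CommutativeRing.rawRing TruncatedRing) (CommutativeRing.rawRing TruncatedRing) (h ∘_)
    map-isRingHomomorphism {h} h-hom = record
      { isSemiringHomomorphism = record
        { isNearSemiringHomomorphism = record
          { +-isMonoidHomomorphism = record
            { isMagmaHomomorphism = record
              { isRelHomomorphism = record { cong = λ f≋g → agree (λ i i≤N → ⟦⟧-cong (agree-at f≋g i i≤N)) }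
              ; homo = λ f g → pointwise (λ i → +-homo (f i) (g i)) }
            ; ε-homo = pointwise (λ _ → 0#-homo) }
          ; *-homo = λ f g → pointwise (map-⊛ h-hom f g) }
        ; 1#-homo = pointwise (λ i → trans (map-const h-hom 1# i) (const-cong 1#-homo i)) }
      ; -‿homo = λ f → pointwise (λ i → -‿homo (f i)) }
      where
      open RingMorphisms.IsRingHomomorphism h-hom
      const-cong : ∀ {a b} → a ≈ b → ∀ i → const a i ≈ const b i
      const-cong a≈b zero    = a≈b
      const-cong a≈b (suc i) = refl

module QuadraticEquation (A : ℚAlgebra) where
  open ℚAlgebra A
  open ℚAlgebraSolver A using (solve; _:=_; _:+_; _:*_; _:-_)
  open import Algebra.Properties.CommutativeSemiring.Exp commutativeSemiring using (_^_; ^-congˡ; ^-distrib-*)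
  open import Algebra.Properties.Semiring.Sum semiring using (sum; sum-syntax; ∑-distrib-+; *-distribˡ-sum; sum-cong-≋)
  open import Relation.Binary.Reasoning.Setoid setoid

  infixl 6 _−_
  _−_ : Carrier → Carrier → Carrier
  x − y = x + - y

  Φ : ∀ {K} → (Fin K → Carrier) → Carrier → Carrier
  Φ {K} a x = 1# + ∑[ k < K ] (a k * x ^ suc (toℕ k))

  quadratic : ∀ {K} → (Fin K → Carrier) → Carrier → Carrier → Carrier
  quadratic a c x = x * x * Φ a x + ι (ℚ.- 2ℚ) * x + c

  Φ-cong : ∀ {K} (a : Fin K → Carrier) {x y} → x ≈ y → Φ a x ≈ Φ a y
  Φ-cong a {x} {y} x≈y = +-cong refl (sum-cong-≋ {x = λ k → a k * x ^ suc (toℕ k)} {y = λ k → a k * y ^ suc (toℕ k)}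
                                      (λ k → *-cong refl (^-congˡ (suc (toℕ k)) x≈y)))

  ∑-split : ∀ {K} (f g e : Fin K → Carrier) d → (∀ k → f k ≈ g k + d * e k) →
            ∑[ k < K ] f k ≈ ∑[ k < K ] g k + d * ∑[ k < K ] e k
  ∑-split {K} f g e d f≈g+de = begin
    ∑[ k < K ] f k                        ≈⟨ sum-cong-≋ f≈g+de ⟩
    ∑[ k < K ] (g k + d * e k)            ≈⟨ ∑-distrib-+ g (λ k → d * e k) ⟩
    ∑[ k < K ] g k + ∑[ k < K ] (d * e k) ≈⟨ +-cong refl (*-distribˡ-sum d e) ⟨
    ∑[ k < K ] g k + d * ∑[ k < K ] e k   ∎

  x²Φ-expand : ∀ {K} (a : Fin K → Carrier) x →
               x * x * Φ a x ≈ x * x + ∑[ k < K ] (a k * x ^ (3 ℕ.+ toℕ k))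
  x²Φ-expand {K} a x = begin
    x * x * Φ a x                                        ≈⟨ distribˡ (x * x) 1# _ ⟩
    x * x * 1# + x * x * ∑[ k < K ] (a k * x ^ suc (toℕ k)) ≈⟨ +-cong (*-identityʳ _) (*-distribˡ-sum (x * x) (λ k → a k * x ^ suc (toℕ k))) ⟩
    x * x + ∑[ k < K ] (x * x * (a k * x ^ suc (toℕ k)))   ≈⟨ +-cong refl (sum-cong-≋ (λ k →
      solve 3 (λ x b X → x :* x :* (b :* (x :* X)) := b :* (x :* (x :* (x :* X)))) refl x (a k) (x ^ toℕ k))) ⟩
    x * x + ∑[ k < K ] (a k * x ^ (3 ℕ.+ toℕ k))          ∎

  homogenise : ∀ {K} (a : Fin K → Carrier) c y x →
    (y * x) * (y * x) * Φ a (y * x) + ι (ℚ.- 2ℚ) * (y * (y * x)) + y * y * c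
      ≈ y * y * quadratic (λ k → a k * y ^ suc (toℕ k)) c x
  homogenise {K} a c y x = begin
    (y * x) * (y * x) * Φ a (y * x) + ι (ℚ.- 2ℚ) * (y * (y * x)) + y * y * c
      ≈⟨ +-cong (+-cong (*-cong refl (+-cong refl (sum-cong-≋ split-power))) refl) refl ⟩
    (y * x) * (y * x) * Φ a′ x + ι (ℚ.- 2ℚ) * (y * (y * x)) + y * y * c
      ≈⟨ solve 5 (λ y x F m c → (y :* x) :* (y :* x) :* F :+ m :* (y :* (y :* x)) :+ y :* y :* c
                              := y :* y :* (x :* x :* F :+ m :* x :+ c)) refl y x (Φ a′ x) (ι (ℚ.- 2ℚ)) c ⟩
    y * y * quadratic a′ c x ∎
    where
    a′ : Fin K → Carrier
    a′ k = a k * y ^ suc (toℕ k)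
    split-power : ∀ k → a k * (y * x) ^ suc (toℕ k) ≈ a′ k * x ^ suc (toℕ k)
    split-power k = trans (*-cong refl (^-distrib-* y x (suc (toℕ k)))) (sym (*-assoc _ _ _))

  module _ {h : Carrier → Carrier} (h-hom : RingMorphisms.IsRingHomomorphism rawRing rawRing h) where
    open RingMorphisms.IsRingHomomorphism h-hom

    ^-homo : ∀ x n → h (x ^ n) ≈ h x ^ n
    ^-homo x zero    = 1#-homo
    ^-homo x (suc n) = trans (*-homo x (x ^ n)) (*-cong refl (^-homo x n))

    sum-homo : ∀ {K} (f : Fin K → Carrier) → h (∑[ k < K ] f k) ≈ ∑[ k < K ] h (f k)
    sum-homo {zero}  f = 0#-homo
    sum-homo {suc K} f = trans (+-homo _ _) (+-cong refl (sum-homo (f ∘ Fin.suc)))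

    quadratic-homo : ∀ {K} (a : Fin K → Carrier) c x → (∀ k → h (a k) ≈ a k) → h c ≈ c →
                     h (ι (ℚ.- 2ℚ)) ≈ ι (ℚ.- 2ℚ) → h (quadratic a c x) ≈ quadratic a c (h x)
    quadratic-homo {K} a c x ha≈a hc≈c h-2≈-2 = begin
      h (quadratic a c x)                                        ≈⟨ +-homo _ _ ⟩
      h (x * x * Φ a x + ι (ℚ.- 2ℚ) * x) + h c                   ≈⟨ +-cong (+-homo _ _) hc≈c ⟩
      h (x * x * Φ a x) + h (ι (ℚ.- 2ℚ) * x) + c                 ≈⟨ +-cong (+-cong x²Φ-homo
                                                                      (trans (*-homo _ _) (*-cong h-2≈-2 refl))) refl ⟩
      quadratic a c (h x)                                        ∎
      where
      Φ-homo : h (Φ a x) ≈ Φ a (h x)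
      Φ-homo = trans (+-homo _ _) (+-cong 1#-homo (trans (sum-homo (λ k → a k * x ^ suc (toℕ k))) (sum-cong-≋ (λ k →
                 trans (*-homo _ _) (*-cong (ha≈a k) (^-homo x (suc (toℕ k))))))))
      x²Φ-homo : h (x * x * Φ a x) ≈ h x * h x * Φ a (h x)
      x²Φ-homo = trans (*-homo _ _) (*-cong (*-homo x x) Φ-homo)

  record RingClosed (P : Carrier → Set) : Set where
    field
      1#-closed : P 1#
      +-closed  : ∀ {x y} → P x → P y → P (x + y)
      *-closed  : ∀ {x y} → P x → P y → P (x * y)
      -‿closed  : ∀ {x} → P x → P (- x)

  ^-closed : ∀ {P} → RingClosed P → ∀ {x} → P x → ∀ n → P (x ^ n)
  ^-closed P-closed Px zero    = RingClosed.1#-closed P-closed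
  ^-closed P-closed Px (suc n) = RingClosed.*-closed P-closed Px (^-closed P-closed Px n)

  module Roots {K} (a : Fin K → Carrier) (c x₁ x₂ : Carrier) where

    s p : Carrier
    s = x₁ + x₂
    p = x₁ * x₂

    -- complete homogeneous symmetric polynomials: h j = ∑_{i ≤ j} x₁^i x₂^(j − i)
    h : ℕ → Carrier
    h zero          = 1#
    h (suc zero)    = s
    h (suc (suc j)) = s * h (suc j) − p * h j

    power-difference : ∀ j → x₁ ^ suc j ≈ x₂ ^ suc j + (x₁ − x₂) * h j
    power-difference zero = solve 3 (λ x y o → x :* o := y :* o :+ (x :- y) :* o) refl x₁ x₂ 1#
    power-difference (suc zero) = begin
      x₁ * (x₁ * 1#)                ≈⟨ *-cong refl (*-identityʳ x₁) ⟩
      x₁ * x₁                       ≈⟨ solve 2 (λ x y → x :* x := y :* y :+ (x :- y) :* (x :+ y)) refl x₁ x₂ ⟩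
      x₂ * x₂ + (x₁ − x₂) * s       ≈⟨ +-cong (*-cong refl (*-identityʳ x₂)) refl ⟨
      x₂ * (x₂ * 1#) + (x₁ − x₂) * s ∎
    power-difference (suc (suc j)) = begin
      x₁ ^ (3 ℕ.+ j)                                            ≈⟨ solve 3 (λ x y X → x :* (x :* X)
                                                                      := (x :+ y) :* (x :* X) :- (x :* y) :* X) refl x₁ x₂ (x₁ ^ suc j) ⟩
      s * x₁ ^ (2 ℕ.+ j) − p * x₁ ^ suc j                       ≈⟨ +-cong (*-cong refl (power-difference (suc j)))
                                                                            (-‿cong (*-cong refl (power-difference j))) ⟩
      s * (x₂ ^ (2 ℕ.+ j) + (x₁ − x₂) * h (suc j)) − p * (x₂ ^ suc j + (x₁ − x₂) * h j)
        ≈⟨ solve 5 (λ x y Y H H′ → (x :+ y) :* (y :* Y :+ (x :- y) :* H) :- (x :* y) :* (Y :+ (x :- y) :* H′)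
                                 := y :* (y :* Y) :+ (x :- y) :* ((x :+ y) :* H :- (x :* y) :* H′))
                   refl x₁ x₂ (x₂ ^ suc j) (h (suc j)) (h j) ⟩
      x₂ ^ (3 ℕ.+ j) + (x₁ − x₂) * h (2 ℕ.+ j)                  ∎

    powerSum : ℕ → Carrier
    powerSum zero          = 1# + 1#
    powerSum (suc zero)    = s
    powerSum (suc (suc r)) = s * powerSum (suc r) − p * powerSum r

    powerSum-correct : ∀ r → x₁ ^ r + x₂ ^ r ≈ powerSum r
    powerSum-correct zero          = refl
    powerSum-correct (suc zero)    = +-cong (*-identityʳ x₁) (*-identityʳ x₂)
    powerSum-correct (suc (suc r)) = begin
      x₁ ^ (2 ℕ.+ r) + x₂ ^ (2 ℕ.+ r)
        ≈⟨ solve 4 (λ x y X Y → x :* (x :* X) :+ y :* (y :* Y)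
                              := (x :+ y) :* (x :* X :+ y :* Y) :- (x :* y) :* (X :+ Y)) refl x₁ x₂ (x₁ ^ r) (x₂ ^ r) ⟩
      s * (x₁ ^ suc r + x₂ ^ suc r) − p * (x₁ ^ r + x₂ ^ r)
        ≈⟨ +-cong (*-cong refl (powerSum-correct (suc r))) (-‿cong (*-cong refl (powerSum-correct r))) ⟩
      powerSum (2 ℕ.+ r) ∎

    module _ {P : Carrier → Set} (P-closed : RingClosed P) (Ps : P s) (Pp : P p) where
      open RingClosed P-closed

      h-closed : ∀ j → P (h j)
      h-closed zero          = 1#-closed
      h-closed (suc zero)    = Ps
      h-closed (suc (suc j)) = +-closed (*-closed Ps (h-closed (suc j))) (-‿closed (*-closed Pp (h-closed j)))

      powerSum-closed : ∀ r → P (powerSum r)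
      powerSum-closed zero          = +-closed 1#-closed 1#-closed
      powerSum-closed (suc zero)    = Ps
      powerSum-closed (suc (suc r)) =
        +-closed (*-closed Ps (powerSum-closed (suc r))) (-‿closed (*-closed Pp (powerSum-closed r)))

    τ τ′ : Carrier
    τ  = ∑[ k < K ] (a k * h (2 ℕ.+ toℕ k))
    τ′ = ∑[ k < K ] (a k * (p * h (suc (toℕ k))))

    quadratic-difference : quadratic a c x₁ ≈ quadratic a c x₂ + (x₁ − x₂) * (s + τ + ι (ℚ.- 2ℚ))
    quadratic-difference = begin
      quadratic a c x₁                                   ≈⟨ +-cong (+-cong (x²Φ-expand a x₁) refl) refl ⟩
      x₁ * x₁ + ∑[ k < K ] (a k * x₁ ^ (3 ℕ.+ toℕ k)) + ι (ℚ.- 2ℚ) * x₁ + c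
        ≈⟨ +-cong (+-cong (+-cong refl (∑-split _ _ _ (x₁ − x₂) (λ k →
             trans (*-cong refl (power-difference (2 ℕ.+ toℕ k)))
                   (solve 4 (λ b X D H → b :* (X :+ D :* H) := b :* X :+ D :* (b :* H)) refl (a k) _ (x₁ − x₂) _)))) refl) refl ⟩
      x₁ * x₁ + (S₂ + (x₁ − x₂) * τ) + ι (ℚ.- 2ℚ) * x₁ + c
        ≈⟨ solve 6 (λ x y S t m c → x :* x :+ (S :+ (x :- y) :* t) :+ m :* x :+ c
                                  := y :* y :+ S :+ m :* y :+ c :+ (x :- y) :* (x :+ y :+ t :+ m))
                   refl x₁ x₂ S₂ τ (ι (ℚ.- 2ℚ)) c ⟩
      x₂ * x₂ + S₂ + ι (ℚ.- 2ℚ) * x₂ + c + (x₁ − x₂) * (s + τ + ι (ℚ.- 2ℚ))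
        ≈⟨ +-cong (+-cong (+-cong (x²Φ-expand a x₂) refl) refl) refl ⟨
      quadratic a c x₂ + (x₁ − x₂) * (s + τ + ι (ℚ.- 2ℚ)) ∎
      where
      S₂ : Carrier
      S₂ = ∑[ k < K ] (a k * x₂ ^ (3 ℕ.+ toℕ k))

    ∑-cross : x₂ * ∑[ k < K ] (a k * x₁ ^ (3 ℕ.+ toℕ k)) ≈ x₁ * ∑[ k < K ] (a k * x₂ ^ (3 ℕ.+ toℕ k)) + (x₁ − x₂) * τ′
    ∑-cross = begin
      x₂ * ∑[ k < K ] (a k * x₁ ^ (3 ℕ.+ toℕ k))               ≈⟨ *-distribˡ-sum x₂ (λ k → a k * x₁ ^ (3 ℕ.+ toℕ k)) ⟩
      ∑[ k < K ] (x₂ * (a k * x₁ ^ (3 ℕ.+ toℕ k)))             ≈⟨ ∑-split _ _ _ (x₁ − x₂) cross-term ⟩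
      ∑[ k < K ] (x₁ * (a k * x₂ ^ (3 ℕ.+ toℕ k))) + (x₁ − x₂) * τ′
                                                               ≈⟨ +-cong (*-distribˡ-sum x₁ (λ k → a k * x₂ ^ (3 ℕ.+ toℕ k))) refl ⟨
      x₁ * ∑[ k < K ] (a k * x₂ ^ (3 ℕ.+ toℕ k)) + (x₁ − x₂) * τ′ ∎
      where
      cross-term : ∀ k → x₂ * (a k * x₁ ^ (3 ℕ.+ toℕ k))
                         ≈ x₁ * (a k * x₂ ^ (3 ℕ.+ toℕ k)) + (x₁ − x₂) * (a k * (p * h (suc (toℕ k))))
      cross-term k = begin
        x₂ * (a k * x₁ ^ (3 ℕ.+ toℕ k))     ≈⟨ solve 4 (λ y b x X → y :* (b :* (x :* X)) := (x :* y) :* (b :* X))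
                                                       refl x₂ (a k) x₁ (x₁ ^ (2 ℕ.+ toℕ k)) ⟩
        p * (a k * x₁ ^ (2 ℕ.+ toℕ k))      ≈⟨ *-cong refl (*-cong refl (power-difference (suc (toℕ k)))) ⟩
        p * (a k * (x₂ ^ (2 ℕ.+ toℕ k) + (x₁ − x₂) * h (suc (toℕ k))))
          ≈⟨ solve 6 (λ x y b Y D H → (x :* y) :* (b :* (y :* Y :+ D :* H))
                                   := x :* (b :* (y :* (y :* Y))) :+ D :* (b :* ((x :* y) :* H)))
                     refl x₁ x₂ (a k) (x₂ ^ suc (toℕ k)) (x₁ − x₂) (h (suc (toℕ k))) ⟩
        x₁ * (a k * x₂ ^ (3 ℕ.+ toℕ k)) + (x₁ − x₂) * (a k * (p * h (suc (toℕ k)))) ∎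

    quadratic-cross : x₂ * quadratic a c x₁ ≈ x₁ * quadratic a c x₂ + (x₁ − x₂) * (p + τ′ − c)
    quadratic-cross = begin
      x₂ * quadratic a c x₁                         ≈⟨ *-cong refl (+-cong (+-cong (x²Φ-expand a x₁) refl) refl) ⟩
      x₂ * (x₁ * x₁ + S₁ + m * x₁ + c)              ≈⟨ solve 5 (λ x y S m c → y :* (x :* x :+ S :+ m :* x :+ c)
                                                                 := y :* S :+ y :* (x :* x :+ m :* x :+ c)) refl x₁ x₂ S₁ m c ⟩
      x₂ * S₁ + x₂ * (x₁ * x₁ + m * x₁ + c)         ≈⟨ +-cong ∑-cross refl ⟩
      x₁ * S₂ + (x₁ − x₂) * τ′ + x₂ * (x₁ * x₁ + m * x₁ + c)
        ≈⟨ solve 6 (λ x y S t m c → x :* S :+ (x :- y) :* t :+ y :* (x :* x :+ m :* x :+ c)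
                                  := x :* (y :* y :+ S :+ m :* y :+ c) :+ (x :- y) :* (x :* y :+ t :- c))
                   refl x₁ x₂ S₂ τ′ m c ⟩
      x₁ * (x₂ * x₂ + S₂ + m * x₂ + c) + (x₁ − x₂) * (p + τ′ − c)
        ≈⟨ +-cong (*-cong refl (+-cong (+-cong (x²Φ-expand a x₂) refl) refl)) refl ⟨
      x₁ * quadratic a c x₂ + (x₁ − x₂) * (p + τ′ − c) ∎
      where
      m S₁ S₂ : Carrier
      m  = ι (ℚ.- 2ℚ)
      S₁ = ∑[ k < K ] (a k * x₁ ^ (3 ℕ.+ toℕ k))
      S₂ = ∑[ k < K ] (a k * x₂ ^ (3 ℕ.+ toℕ k))

    module _ (w : Carrier) (wE₁≈0 : w * quadratic a c x₁ ≈ 0#) (wE₂≈0 : w * quadratic a c x₂ ≈ 0#) where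

      s-relation : (x₁ − x₂) * (w * (s + τ + ι (ℚ.- 2ℚ))) ≈ 0#
      s-relation = begin
        (x₁ − x₂) * (w * R)                     ≈⟨ solve 4 (λ D w R E → D :* (w :* R) := w :* (E :+ D :* R) :- w :* E)
                                                            refl (x₁ − x₂) w R (quadratic a c x₂) ⟩
        w * (E₂ + (x₁ − x₂) * R) − w * E₂        ≈⟨ +-cong (*-cong refl quadratic-difference) refl ⟨
        w * quadratic a c x₁ − w * E₂            ≈⟨ +-cong wE₁≈0 (-‿cong wE₂≈0) ⟩
        0# − 0#                                  ≈⟨ -‿inverseʳ 0# ⟩
        0#                                       ∎
        where
        R E₂ : Carrier
        R  = s + τ + ι (ℚ.- 2ℚ)
        E₂ = quadratic a c x₂

      p-relation : (x₁ − x₂) * (w * (p + τ′ − c)) ≈ 0#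
      p-relation = begin
        (x₁ − x₂) * (w * R)                      ≈⟨ solve 6 (λ D w R E y x → D :* (w :* R) := w :* (x :* E :+ D :* R) :- x :* (w :* E))
                                                             refl (x₁ − x₂) w R E₂ x₂ x₁ ⟩
        w * (x₁ * E₂ + (x₁ − x₂) * R) − x₁ * (w * E₂) ≈⟨ +-cong (*-cong refl quadratic-cross) refl ⟨
        w * (x₂ * quadratic a c x₁) − x₁ * (w * E₂)   ≈⟨ +-cong (solve 3 (λ w y E → w :* (y :* E) := y :* (w :* E)) refl w x₂ _) refl ⟩
        x₂ * (w * quadratic a c x₁) − x₁ * (w * E₂)   ≈⟨ +-cong (*-cong refl wE₁≈0) (-‿cong (*-cong refl wE₂≈0)) ⟩
        x₂ * 0# − x₁ * 0#                             ≈⟨ +-cong (zeroʳ x₂) (-‿cong (zeroʳ x₁)) ⟩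
        0# − 0#                                       ≈⟨ -‿inverseʳ 0# ⟩
        0#                                            ∎
        where
        R E₂ : Carrier
        R  = p + τ′ − c
        E₂ = quadratic a c x₂

neg1^ℕ : ℕ → ℚ
neg1^ℕ zero    = 1ℚ
neg1^ℕ (suc n) = ℚ.- neg1^ℕ n

neg1^ : ℤ → ℚ
neg1^ (+ n)    = neg1^ℕ n
neg1^ -[1+ n ] = neg1^ℕ (suc n)

private
  neg-neg : ∀ a → ℚ.- (ℚ.- a) ≡ a
  neg-neg = solve 1 (λ a → :- (:- a) := a) ≡.refl
    where open +-*-Solver

  neg-*-neg : ∀ a b → ℚ.- a ℚ.* ℚ.- b ≡ a ℚ.* b
  neg-*-neg = solve 2 (λ a b → (:- a) :* (:- b) := a :* b) ≡.refl
    where open +-*-Solver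

neg1^ℕ-+ : ∀ m n → neg1^ℕ (m ℕ.+ n) ≡ neg1^ℕ m ℚ.* neg1^ℕ n
neg1^ℕ-+ zero    n = ≡.sym (ℚₚ.*-identityˡ _)
neg1^ℕ-+ (suc m) n = ≡.trans (cong ℚ.-_ (neg1^ℕ-+ m n)) (ℚₚ.neg-distribˡ-* (neg1^ℕ m) (neg1^ℕ n))

neg1^ℕ-square : ∀ n → neg1^ℕ n ℚ.* neg1^ℕ n ≡ 1ℚ
neg1^ℕ-square zero    = ≡.refl
neg1^ℕ-square (suc n) = ≡.trans (neg-*-neg (neg1^ℕ n) (neg1^ℕ n)) (neg1^ℕ-square n)

neg1^ℕ-even : ∀ n → neg1^ℕ (2 ℕ.* n) ≡ 1ℚ
neg1^ℕ-even n = ≡.trans (cong (λ m → neg1^ℕ (n ℕ.+ m)) (ℕₚ.+-identityʳ n))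
                        (≡.trans (neg1^ℕ-+ n n) (neg1^ℕ-square n))

neg1^-⊖ : ∀ m n → neg1^ (m ℤ.⊖ n) ≡ neg1^ℕ m ℚ.* neg1^ℕ n
neg1^-⊖ m       zero    = ≡.sym (ℚₚ.*-identityʳ _)
neg1^-⊖ zero    (suc n) = ≡.sym (ℚₚ.*-identityˡ _)
neg1^-⊖ (suc m) (suc n) = ≡.trans (cong neg1^ (ℤₚ.[1+m]⊖[1+n]≡m⊖n m n))
                                  (≡.trans (neg1^-⊖ m n) (≡.sym (neg-*-neg (neg1^ℕ m) (neg1^ℕ n))))

neg1^-+ : ∀ e f → neg1^ (e ℤ.+ f) ≡ neg1^ e ℚ.* neg1^ f
neg1^-+ (+ m)    (+ n)    = neg1^ℕ-+ m n
neg1^-+ (+ m)    -[1+ n ] = neg1^-⊖ m (suc n)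
neg1^-+ -[1+ m ] (+ n)    = ≡.trans (neg1^-⊖ n (suc m)) (ℚₚ.*-comm (neg1^ℕ n) (neg1^ℕ (suc m)))
neg1^-+ -[1+ m ] -[1+ n ] =
  ≡.trans (neg-neg _) (≡.trans (neg1^ℕ-+ m n) (≡.sym (neg-*-neg (neg1^ℕ m) (neg1^ℕ n))))

flipTerm : ℚ × Mono → ℚ × Mono
flipTerm (a , (e , es)) = (neg1^ e ℚ.* a , (e , es))

negateU : Poly → Poly
negateU = map flipTerm

eqMono⇒exponent≡ : ∀ n m → eqMono n m ≡ true → proj₁ n ≡ proj₁ m
eqMono⇒exponent≡ (e , as) (f , bs) eq with e ℤ.≟ f
eqMono⇒exponent≡ (e , as) (f , bs) eq | yes e≡f = e≡f
eqMono⇒exponent≡ (e , as) (f , bs) () | no _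

coeff-negateU : ∀ p m → coeff (negateU p) m ≡ neg1^ (proj₁ m) ℚ.* coeff p m
coeff-negateU p m = begin
  coeff (negateU p) m                                   ≡⟨ coeff-∑ₗ (negateU p) m ⟩
  ∑ₗ (negateU p) (termCoeff m)                          ≡⟨ ∑ₗ-map flipTerm p _ ⟩
  ∑ₗ p (termCoeff m ∘ flipTerm)                        ≡⟨ ∑ₗ-cong p sign-out ⟩
  ∑ₗ p (λ t → neg1^ (proj₁ m) ℚ.* termCoeff m t)        ≡⟨ ∑ₗ-*ˡ p (neg1^ (proj₁ m)) (termCoeff m) ⟩
  neg1^ (proj₁ m) ℚ.* ∑ₗ p (termCoeff m)                ≡⟨ cong (neg1^ (proj₁ m) ℚ.*_) (coeff-∑ₗ p m) ⟨
  neg1^ (proj₁ m) ℚ.* coeff p m                         ∎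
  where
  open ≡.≡-Reasoning
  sign-out : ∀ t → termCoeff m (flipTerm t) ≡ neg1^ (proj₁ m) ℚ.* termCoeff m t
  sign-out (a , n) with eqMono n m in n≈m
  ... | true  = cong (λ e → neg1^ e ℚ.* a) (eqMono⇒exponent≡ n m n≈m)
  ... | false = ≡.sym (ℚₚ.*-zeroʳ (neg1^ (proj₁ m)))

negateU-*P : ∀ p q → negateU (p *P q) ≈P negateU p *P negateU q
negateU-*P p q m = begin
  coeff (negateU (p *P q)) m                                  ≡⟨ coeff-negateU (p *P q) m ⟩
  σ ℚ.* coeff (p *P q) m                                      ≡⟨ cong (σ ℚ.*_) (coeff-*P p q m) ⟩
  σ ℚ.* ∑ₗ p (λ s → ∑ₗ q (productCoeff m s))                  ≡⟨ ∑ₗ-*ˡ p σ _ ⟨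
  ∑ₗ p (λ s → σ ℚ.* ∑ₗ q (productCoeff m s))                  ≡⟨ ∑ₗ-cong p (λ s →
                                                                   ≡.trans (≡.sym (∑ₗ-*ˡ q σ _)) (∑ₗ-cong q (sign-split s))) ⟩
  ∑ₗ p (λ s → ∑ₗ q (productCoeff m (flipTerm s) ∘ flipTerm)) ≡⟨ ∑ₗ-cong p (λ s → ∑ₗ-map flipTerm q _) ⟨
  ∑ₗ p (λ s → ∑ₗ (negateU q) (productCoeff m (flipTerm s)))   ≡⟨ ∑ₗ-map flipTerm p _ ⟨
  ∑ₗ (negateU p) (λ s → ∑ₗ (negateU q) (productCoeff m s))    ≡⟨ coeff-*P (negateU p) (negateU q) m ⟨
  coeff (negateU p *P negateU q) m                            ∎
  where
  open ≡.≡-Reasoning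
  σ : ℚ
  σ = neg1^ (proj₁ m)
  sign-split : ∀ s t → σ ℚ.* productCoeff m s t ≡ productCoeff m (flipTerm s) (flipTerm t)
  sign-split (a , n) (b , n′) with eqMono (mulMono n n′) m in nn′≈m
  ... | false = ℚₚ.*-zeroʳ σ
  ... | true  = begin
    σ ℚ.* (a ℚ.* b)                                         ≡⟨ cong (λ e → neg1^ e ℚ.* (a ℚ.* b))
                                                                  (eqMono⇒exponent≡ (mulMono n n′) m nn′≈m) ⟨
    neg1^ (proj₁ n ℤ.+ proj₁ n′) ℚ.* (a ℚ.* b)              ≡⟨ cong (ℚ._* (a ℚ.* b)) (neg1^-+ (proj₁ n) (proj₁ n′)) ⟩
    (neg1^ (proj₁ n) ℚ.* neg1^ (proj₁ n′)) ℚ.* (a ℚ.* b)    ≡⟨ interchange (neg1^ (proj₁ n)) (neg1^ (proj₁ n′)) a b ⟩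
    (neg1^ (proj₁ n) ℚ.* a) ℚ.* (neg1^ (proj₁ n′) ℚ.* b)    ∎
    where
    interchange : ∀ w x y z → (w ℚ.* x) ℚ.* (y ℚ.* z) ≡ (w ℚ.* y) ℚ.* (x ℚ.* z)
    interchange = solve 4 (λ w x y z → (w :* x) :* (y :* z) := (w :* y) :* (x :* z)) ≡.refl
      where open +-*-Solver

negateU-isRingHomomorphism :
  RingMorphisms.IsRingHomomorphism (CommutativeRing.rawRing PolyRing) (CommutativeRing.rawRing PolyRing) negateU
negateU-isRingHomomorphism = record
  { isSemiringHomomorphism = record
    { isNearSemiringHomomorphism = record
      { +-isMonoidHomomorphism = record
        { isMagmaHomomorphism = record
          { isRelHomomorphism = record { cong = λ {p} {q} p≃q → coeffwise (λ m →
              ≡.trans (coeff-negateU p m) (≡.trans (cong (neg1^ (proj₁ m) ℚ.*_) (coeff≡ p≃q m)) (≡.sym (coeff-negateU q m)))) }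
          ; homo = λ p q → coeffwise (λ m → cong (λ r → coeff r m) (Listₚ.map-++ flipTerm p q)) }
        ; ε-homo = coeffwise (λ _ → ≡.refl) }
      ; *-homo = λ p q → coeffwise (negateU-*P p q) }
    ; 1#-homo = coeffwise (λ _ → ≡.refl) }
  ; -‿homo = λ p → coeffwise (λ m → begin
      coeff (negateU (-P p)) m                    ≡⟨ coeff-negateU (-P p) m ⟩
      neg1^ (proj₁ m) ℚ.* coeff (-P p) m          ≡⟨ cong (neg1^ (proj₁ m) ℚ.*_) (coeff-· (ℚ.- 1ℚ) p m) ⟩
      neg1^ (proj₁ m) ℚ.* (ℚ.- 1ℚ ℚ.* coeff p m)  ≡⟨ swap (neg1^ (proj₁ m)) (ℚ.- 1ℚ) (coeff p m) ⟩
      ℚ.- 1ℚ ℚ.* (neg1^ (proj₁ m) ℚ.* coeff p m)  ≡⟨ cong (ℚ.- 1ℚ ℚ.*_) (coeff-negateU p m) ⟨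
      ℚ.- 1ℚ ℚ.* coeff (negateU p) m              ≡⟨ coeff-· (ℚ.- 1ℚ) (negateU p) m ⟨
      coeff (-P negateU p) m                      ∎) }
  where
  open ≡.≡-Reasoning
  swap : ∀ x y z → x ℚ.* (y ℚ.* z) ≡ y ℚ.* (x ℚ.* z)
  swap = solve 3 (λ x y z → x :* (y :* z) := y :* (x :* z)) ≡.refl
    where open +-*-Solver

negateU-cong : ∀ {p q} → p ≃ q → negateU p ≃ negateU q
negateU-cong = RingMorphisms.IsRingHomomorphism.⟦⟧-cong negateU-isRingHomomorphism

record NoNegPowers (p : Poly) : Set where
  constructor noNegPowers
  field coeff-negative : ∀ j es → coeff p (-[1+ j ] , es) ≡ 0ℚ
open NoNegPowers

NoNegPowers-cong : ∀ {p q} → p ≈P q → NoNegPowers p → NoNegPowers q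
NoNegPowers-cong p≈q p⁺ = noNegPowers (λ j es → ≡.trans (≡.sym (p≈q (-[1+ j ] , es))) (coeff-negative p⁺ j es))

NoNegPowers-+P : ∀ {p q} → NoNegPowers p → NoNegPowers q → NoNegPowers (p +P q)
NoNegPowers-+P {p} {q} p⁺ q⁺ = noNegPowers (λ j es →
  ≡.trans (coeff-++ p q (-[1+ j ] , es)) (cong₂ ℚ._+_ (coeff-negative p⁺ j es) (coeff-negative q⁺ j es)))

NoNegPowers-·P : ∀ a {p} → NoNegPowers p → NoNegPowers (a ·P p)
NoNegPowers-·P a {p} p⁺ = noNegPowers (λ j es →
  ≡.trans (coeff-· a p (-[1+ j ] , es)) (≡.trans (cong (a ℚ.*_) (coeff-negative p⁺ j es)) (ℚₚ.*-zeroʳ a)))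

private
  eqMono-nonneg-neg : ∀ n j as bs → eqMono (+ n , as) (-[1+ j ] , bs) ≡ false
  eqMono-nonneg-neg n j as bs = cong (_∧ eqExps as bs) (dec-false (+ n ℤ.≟ -[1+ j ]) (λ ()))

  eqMono-neg-nonneg : ∀ n j as bs → eqMono (-[1+ j ] , as) (+ n , bs) ≡ false
  eqMono-neg-nonneg n j as bs = cong (_∧ eqExps as bs) (dec-false (-[1+ j ] ℤ.≟ + n) (λ ()))

NoNegPowers-monomial : ∀ a n es → NoNegPowers ((a , (+ n , es)) ∷ [])
NoNegPowers-monomial a n es = noNegPowers (λ j es′ → cong (λ b → when b a ℚ.+ 0ℚ) (eqMono-nonneg-neg n j es es′))

NatPoly : Set
NatPoly = List (ℚ × ℕ × Exps)

embedNat : NatPoly → Poly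
embedNat = map (λ (a , n , es) → (a , (+ n , es)))

natPart : Poly → NatPoly
natPart []                          = []
natPart ((a , (+ n , es)) ∷ p)      = (a , n , es) ∷ natPart p
natPart ((a , (-[1+ _ ] , _)) ∷ p)  = natPart p

private
  coeff-natPart : ∀ p n es → coeff (embedNat (natPart p)) (+ n , es) ≡ coeff p (+ n , es)
  coeff-natPart []                       n es = ≡.refl
  coeff-natPart ((a , (+ k , as)) ∷ p)   n es with eqMono (+ k , as) (+ n , es)
  ... | true  = cong (a ℚ.+_) (coeff-natPart p n es)
  ... | false = coeff-natPart p n es
  coeff-natPart ((a , (-[1+ j ] , as)) ∷ p) n es rewrite eqMono-neg-nonneg n j as es = coeff-natPart p n es

  coeff-embedNat-negative : ∀ L j es → coeff (embedNat L) (-[1+ j ] , es) ≡ 0ℚ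
  coeff-embedNat-negative []                 j es = ≡.refl
  coeff-embedNat-negative ((a , n , as) ∷ L) j es rewrite eqMono-nonneg-neg n j as es = coeff-embedNat-negative L j es

-- The list representing p may contain cancelling terms with negative exponent of u; natPart drops them.
natPart-≈P : ∀ {p} → NoNegPowers p → embedNat (natPart p) ≈P p
natPart-≈P {p} p⁺ (+ n , es)      = coeff-natPart p n es
natPart-≈P {p} p⁺ (-[1+ j ] , es) = ≡.trans (coeff-embedNat-negative (natPart p) j es) (≡.sym (coeff-negative p⁺ j es))

NoNegPowers-*P : ∀ {p q} → NoNegPowers p → NoNegPowers q → NoNegPowers (p *P q)
NoNegPowers-*P {p} {q} p⁺ q⁺ = NoNegPowers-cong {embedNat (natPart p) *P embedNat (natPart q)}
  (coeff≡ (CommutativeRing.*-cong PolyRing {embedNat (natPart p)} {p} {embedNat (natPart q)} {q}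
                                          (coeffwise (natPart-≈P p⁺)) (coeffwise (natPart-≈P q⁺))))
  (noNegPowers (λ j es → product-negative (natPart p) (natPart q) j es))
  where
  product-negative : ∀ L L′ j es → coeff (embedNat L *P embedNat L′) (-[1+ j ] , es) ≡ 0ℚ
  product-negative L L′ j es = ≡.trans (coeff-*P (embedNat L) (embedNat L′) _) (≡.trans (∑ₗ-map _ L _)
    (≡.trans (∑ₗ-cong L (λ (a , n , as) → ≡.trans (∑ₗ-map _ L′ _) (≡.trans (∑ₗ-cong L′ (λ (b , n′ , as′) →
       cong (λ c → when c (a ℚ.* b)) (eqMono-nonneg-neg (n ℕ.+ n′) j (addExps as as′) es))) (∑ₗ-zero L′))))
    (∑ₗ-zero L)))

*P-cancel-monomial : ∀ c d → c ℚ.* d ≡ 1ℚ → ∀ x → ((c , (+ 1 , [])) ∷ []) *P x ≈P 0P → x ≈P 0P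
*P-cancel-monomial c d cd≡1 x cux≈0 (e , es) = begin
  coeff x (e , es)                       ≡⟨ cong (λ f → coeff x (f , es)) (+-−-cancel e (+ 1)) ⟨
  coeff x (e′ , es)                      ≡⟨ ℚₚ.*-identityʳ _ ⟨
  coeff x (e′ , es) ℚ.* 1ℚ               ≡⟨ cong (coeff x (e′ , es) ℚ.*_) cd≡1 ⟨
  coeff x (e′ , es) ℚ.* (c ℚ.* d)        ≡⟨ ℚₚ.*-assoc (coeff x (e′ , es)) c d ⟨
  coeff x (e′ , es) ℚ.* c ℚ.* d          ≡⟨ cong (ℚ._* d) (ℚₚ.+-identityʳ (coeff x (e′ , es) ℚ.* c)) ⟨
  (coeff x (e′ , es) ℚ.* c ℚ.+ 0ℚ) ℚ.* d ≡⟨ cong (ℚ._* d) (coeff-*P-divMono x cu (e ℤ.+ + 1 , es)) ⟨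
  coeff (x *P cu) (e ℤ.+ + 1 , es) ℚ.* d ≡⟨ cong (ℚ._* d) (≡.trans (*P-comm x cu _) (cux≈0 _)) ⟩
  0ℚ ℚ.* d                               ≡⟨ ℚₚ.*-zeroˡ d ⟩
  0ℚ                                     ∎
  where
  open ≡.≡-Reasoning
  cu : Poly
  cu = (c , (+ 1 , [])) ∷ []
  e′ : ℤ
  e′ = e ℤ.+ + 1 ℤ.- + 1


open PowerSeries PolyAlgebra

private
  module P  = CommutativeRing PolyRing
  module PΣ = Algebra.Properties.Semiring.Sum P.semiring

NoNegPowers< : ℕ → Series → Set
NoNegPowers< n f = ∀ i → i < n → NoNegPowers (f i)

module _ {n : ℕ} where

  NoNegPowers<-cong : ∀ {f g} → (∀ i → i < n → f i ≃ g i) → NoNegPowers< n f → NoNegPowers< n g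
  NoNegPowers<-cong f≃g f⁺ i i<n = NoNegPowers-cong (coeff≡ (f≃g i i<n)) (f⁺ i i<n)

  NoNegPowers<-⊕ : ∀ {f g} → NoNegPowers< n f → NoNegPowers< n g → NoNegPowers< n (f ⊕ g)
  NoNegPowers<-⊕ f⁺ g⁺ i i<n = NoNegPowers-+P (f⁺ i i<n) (g⁺ i i<n)

  NoNegPowers<-⊝ : ∀ {f} → NoNegPowers< n f → NoNegPowers< n (⊝ f)
  NoNegPowers<-⊝ f⁺ i i<n = NoNegPowers-·P (ℚ.- 1ℚ) (f⁺ i i<n)

  NoNegPowers<-const : ∀ {p} → NoNegPowers p → NoNegPowers< n (const p)
  NoNegPowers<-const p⁺ zero    _ = p⁺
  NoNegPowers<-const p⁺ (suc i) _ = noNegPowers (λ _ _ → ≡.refl)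

  NoNegPowers<-⊛ : ∀ {f g} → NoNegPowers< n f → NoNegPowers< n g → NoNegPowers< n (f ⊛ g)
  NoNegPowers<-⊛ {f} {g} f⁺ g⁺ i i<n = coefficient i f (λ j j≤i → f⁺ j (ℕₚ.≤-<-trans j≤i i<n))
                                                     (λ j j≤i → g⁺ j (ℕₚ.≤-<-trans j≤i i<n))
    where
    coefficient : ∀ i f → (∀ j → j ≤ i → NoNegPowers (f j)) → (∀ j → j ≤ i → NoNegPowers (g j)) →
                  NoNegPowers ((f ⊛ g) i)
    coefficient zero f f⁺ g⁺ =
      NoNegPowers-cong (coeff≡ (P.sym (⊛-zero f g))) (NoNegPowers-*P (f⁺ 0 z≤n) (g⁺ 0 z≤n))
    coefficient (suc i) f f⁺ g⁺ = subst NoNegPowers (≡.sym (⊛-suc f g i))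
      (NoNegPowers-+P (NoNegPowers-*P (f⁺ 0 z≤n) (g⁺ (suc i) ℕₚ.≤-refl))
                      (coefficient i (tail f) (λ j j≤i → f⁺ (suc j) (s≤s j≤i)) (λ j j≤i → g⁺ j (ℕₚ.m≤n⇒m≤1+n j≤i))))

NoNegPowers<-Y⊛ : ∀ {n f} → NoNegPowers< n f → NoNegPowers< (suc n) (Y ⊛ f)
NoNegPowers<-Y⊛ {f = f} f⁺ zero    _         = NoNegPowers-cong {0P} (coeff≡ (P.sym (Y-⊛ f 0))) (noNegPowers (λ _ _ → ≡.refl))
NoNegPowers<-Y⊛ {f = f} f⁺ (suc i) (s≤s i<n) = NoNegPowers-cong (coeff≡ (P.sym (Y-⊛ f (suc i)))) (f⁺ i i<n)


·P-≃-constP-*P : ∀ a p → a ·P p ≃ constP a *P p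
·P-≃-constP-*P a p = coeffwise (λ m → begin
  coeff (a ·P p) m                          ≡⟨ coeff-· a p m ⟩
  a ℚ.* coeff p m                           ≡⟨ cong (a ℚ.*_) (coeff-∑ₗ p m) ⟩
  a ℚ.* ∑ₗ p (termCoeff m)                  ≡⟨ ∑ₗ-*ˡ p a _ ⟨
  ∑ₗ p (λ t → a ℚ.* termCoeff m t)          ≡⟨ ∑ₗ-cong p (λ (b , n) → ≡.sym (≡.trans
                                                   (cong (λ k → when (eqMono k m) (a ℚ.* b)) (mulMono-identityˡ n))
                                                   (when-*ˡ (eqMono n m) a b))) ⟩
  ∑ₗ p (productCoeff m (a , (+ 0 , [])))    ≡⟨ ℚₚ.+-identityʳ _ ⟨
  ∑ₗ p (productCoeff m (a , (+ 0 , []))) ℚ.+ 0ℚ ≡⟨ coeff-*P (constP a) p m ⟨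
  coeff (constP a *P p) m                   ∎)
  where open ≡.≡-Reasoning

sumP-applyUpTo : ∀ (h : ℕ → Poly) f j → sumP (map h (applyUpTo f j)) ≡ PΣ.sum {j} (λ k → h (f (toℕ k)))
sumP-applyUpTo h f zero    = ≡.refl
sumP-applyUpTo h f (suc j) = cong (h (f 0) +P_) (sumP-applyUpTo h (f ∘ suc) j)

PΣ-extend : ∀ (h : ℕ → Poly) j K → j ≤ K → (∀ k → j ≤ k → h k ≃ 0P) →
            PΣ.sum {j} (h ∘ toℕ) ≃ PΣ.sum {K} (h ∘ toℕ)
PΣ-extend h zero    K       _         h≃0 =
  P.sym (P.trans (PΣ.sum-cong-≋ {K} {x = h ∘ toℕ} {y = λ _ → 0P} (λ k → h≃0 (toℕ k) z≤n)) (PΣ.sum-replicate-zero K))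
PΣ-extend h (suc j) (suc K) (s≤s j≤K) h≃0 =
  P.+-cong P.refl (PΣ-extend (h ∘ suc) j K j≤K (λ k j≤k → h≃0 (suc k) (s≤s j≤k)))

isolate : ∀ {x y z} → x +P y +P z ≃ 0P → x ≃ -P y +P -P z
isolate {x} {y} {z} x+y+z≃0 = P.trans
  (solve 3 (λ x y z → x := x :+ y :+ z :- y :- z) P.refl x y z)
  (P.trans (P.+-cong (P.+-cong x+y+z≃0 P.refl) P.refl) (P.+-cong (P.+-identityˡ (-P y)) P.refl))
  where open ℚAlgebraSolver PolyAlgebra using (solve; _:=_; _:+_; _:-_)

NoNegPowers<-Y : ∀ {n} → NoNegPowers< n Y
NoNegPowers<-Y zero          _ = noNegPowers (λ _ _ → ≡.refl)
NoNegPowers<-Y (suc zero)    _ = NoNegPowers-monomial 1ℚ 0 []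
NoNegPowers<-Y (suc (suc i)) _ = noNegPowers (λ _ _ → ≡.refl)

-- series modulo y^(3 + N); the extra y² is consumed when passing from Z to Z / y
module Modulo (N : ℕ) where
  open Truncated (2 ℕ.+ N) public
  open QuadraticEquation TruncatedAlgebra public

  M : ℕ
  M = 2 ℕ.+ N

  private
    module S  = CommutativeRing TruncatedRing
    module SΣ = Algebra.Properties.Semiring.Sum S.semiring
  open import Algebra.Properties.CommutativeSemiring.Exp S.commutativeSemiring using (^-congˡ; ^-distrib-*)

  NoNegPowers<-ringClosed : ∀ n → RingClosed (NoNegPowers< n)
  NoNegPowers<-ringClosed n = record
    { 1#-closed = NoNegPowers<-const (NoNegPowers-monomial 1ℚ 0 [])
    ; +-closed  = NoNegPowers<-⊕
    ; *-closed  = NoNegPowers<-⊛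
    ; -‿closed  = NoNegPowers<-⊝
    }

  NoNegPowers<-sum : ∀ {n K} {f : Fin K → Series} → (∀ k → NoNegPowers< n (f k)) → NoNegPowers< n (SΣ.sum f)
  NoNegPowers<-sum {K = zero}  _  i _ = noNegPowers (λ _ _ → ≡.refl)
  NoNegPowers<-sum {K = suc K} f⁺     = NoNegPowers<-⊕ (f⁺ Fin.zero) (NoNegPowers<-sum (f⁺ ∘ Fin.suc))

  ^S≃^ : ∀ F r i → (F ^S r) i ≃ (F ^ r) i
  ^S≃^ F zero    zero    = P.refl
  ^S≃^ F zero    (suc i) = P.refl
  ^S≃^ F (suc r) i       = ⊛-cong {F} {F} {F ^S r} {F ^ r} i (λ _ _ → P.refl) (λ j _ → ^S≃^ F r j)

  φs : ∀ K → Fin K → Series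
  φs K k = const (φP (toℕ k))

  ΦS≃Φ : ∀ F → F 0 ≃ 0P → ∀ K i → i ≤ K → ΦS F i ≃ Φ (φs K) F i
  ΦS≃Φ F F₀≃0 K i i≤K = P.+-cong (1S≃𝟙 i) (begin
    sumP (map term (upTo i))                         ≡⟨ sumP-applyUpTo term id i ⟩
    PΣ.sum {i} (term ∘ toℕ)                          ≈⟨ PΣ-extend term i K i≤K term-vanishes ⟩
    PΣ.sum {K} (term ∘ toℕ)                          ≈⟨ PΣ.sum-cong-≋ {K} {x = term ∘ toℕ} (λ k → term≃ (toℕ k)) ⟩
    PΣ.sum {K} (λ k → (φs K k ⊛ F ^ suc (toℕ k)) i)  ≡⟨ sum-at (λ k → φs K k ⊛ F ^ suc (toℕ k)) ⟨
    SΣ.sum (λ k → φs K k ⊛ F ^ suc (toℕ k)) i        ∎)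
    where
    open import Relation.Binary.Reasoning.Setoid P.setoid
    term : ℕ → Poly
    term k = φP k *P (F ^S suc k) i
    1S≃𝟙 : ∀ i → 1S i ≃ 𝟙 i
    1S≃𝟙 zero    = P.refl
    1S≃𝟙 (suc i) = P.refl
    term≃ : ∀ k → term k ≃ (const (φP k) ⊛ F ^ suc k) i
    term≃ k = P.trans (P.*-congˡ {φP k} (^S≃^ F (suc k) i)) (P.sym (const-⊛ (φP k) (F ^ suc k) i))
    term-vanishes : ∀ k → i ≤ k → term k ≃ 0P
    term-vanishes k i≤k = P.trans (P.*-congˡ {φP k} (P.trans (^S≃^ F (suc k) i) (^-vanish F F₀≃0 (suc k) i (s≤s i≤k))))
                                  (P.zeroʳ (φP k))
    sum-at : ∀ {K} (g : Fin K → Series) → SΣ.sum g i ≡ PΣ.sum (λ k → g k i)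
    sum-at {zero}  g = ≡.refl
    sum-at {suc K} g = cong (g Fin.zero i +P_) (sum-at (g ∘ Fin.suc))

  c₀ : Poly
  c₀ = 1P +P -P (uP *P uP)

  eqnSeries : ℕ → Series → Series
  eqnSeries K F = F ⊛ F ⊛ Φ (φs K) F ⊕ const (constP (ℚ.- 2ℚ)) ⊛ (Y ⊛ F) ⊕ Y ⊛ Y ⊛ const c₀

  eqnLHS≋eqnSeries : ∀ F → F 0 ≃ 0P → eqnLHS F ≋ eqnSeries M F
  eqnLHS≋eqnSeries F F₀≃0 = agree (λ i i≤M → P.+-cong (P.+-cong
    (⊛-cong {F ⊛ F} {F ⊛ F} {ΦS F} {Φ (φs M) F} i (λ _ _ → P.refl) (λ j j≤i → ΦS≃Φ F F₀≃0 M j (ℕₚ.≤-trans j≤i i≤M)))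
    (linear i))
    (P.trans (≡⇒≈ (cS≡ i)) (P.trans (P.sym (Y²-⊛ (const c₀) i)) (P.sym (⊛-assoc Y Y (const c₀) i)))))
    where
    yS≡shift : ∀ i → yS F i ≡ shift F i
    yS≡shift zero    = ≡.refl
    yS≡shift (suc i) = ≡.refl
    linear : ∀ i → (ℚ.- 2ℚ) ·P yS F i ≃ (const (constP (ℚ.- 2ℚ)) ⊛ (Y ⊛ F)) i
    linear i = P.trans (·P-≃-constP-*P (ℚ.- 2ℚ) (yS F i))
      (P.trans (P.*-congˡ {constP (ℚ.- 2ℚ)} (P.trans (≡⇒≈ (yS≡shift i)) (P.sym (Y-⊛ F i))))
               (P.sym (const-⊛ (constP (ℚ.- 2ℚ)) (Y ⊛ F) i)))
    cS≡ : ∀ i → cS i ≡ shift (shift (const c₀)) i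
    cS≡ 0                     = ≡.refl
    cS≡ 1                     = ≡.refl
    cS≡ 2                     = ≡.refl
    cS≡ (suc (suc (suc i)))   = ≡.refl
    Y²-⊛ : ∀ f i → (Y ⊛ (Y ⊛ f)) i ≃ shift (shift f) i
    Y²-⊛ f zero    = Y-⊛ (Y ⊛ f) 0
    Y²-⊛ f (suc i) = P.trans (Y-⊛ (Y ⊛ f) (suc i)) (Y-⊛ f i)

  eqnSeries-cong : ∀ K {F F′} → F ≋ F′ → eqnSeries K F ≋ eqnSeries K F′
  eqnSeries-cong K F≋F′ = S.+-cong (S.+-cong (S.*-cong (S.*-cong F≋F′ F≋F′) (Φ-cong (φs K) F≋F′))
                                             (S.*-congˡ {const (constP (ℚ.- 2ℚ))} (S.*-congˡ {Y} F≋F′)))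
                                   S.refl

  ψ : Fin M → Series
  ψ k = φs M k ⊛ Y ^ suc (toℕ k)

  ≋-Y⊛tail : ∀ {F} → F 0 ≃ 0P → F ≋ Y ⊛ tail F
  ≋-Y⊛tail {F} F₀≃0 = pointwise (λ
    { zero    → P.trans F₀≃0 (P.sym (Y-⊛ (tail F) 0))
    ; (suc i) → P.sym (Y-⊛ (tail F) (suc i)) })

  reduced-equation : ∀ {F} → F 0 ≃ 0P → eqnLHS F ≋ 𝟘 → Y ⊛ Y ⊛ quadratic ψ (const c₀) (tail F) ≋ 𝟘
  reduced-equation {F} F₀≃0 eqn = begin
    Y ⊛ Y ⊛ quadratic ψ (const c₀) (tail F)      ≈⟨ homogenise (φs M) (const c₀) Y (tail F) ⟨
    eqnSeries M (Y ⊛ tail F)                     ≈⟨ eqnSeries-cong M (≋-Y⊛tail {F} F₀≃0) ⟨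
    eqnSeries M F                                ≈⟨ eqnLHS≋eqnSeries F F₀≃0 ⟨
    eqnLHS F                                     ≈⟨ eqn ⟩
    𝟘                                            ∎
    where open import Relation.Binary.Reasoning.Setoid S.setoid

  negateUˢ-isRingHomomorphism : RingMorphisms.IsRingHomomorphism S.rawRing S.rawRing (negateU ∘_)
  negateUˢ-isRingHomomorphism = map-isRingHomomorphism negateU-isRingHomomorphism

  private
    open RingMorphisms.IsRingHomomorphism negateUˢ-isRingHomomorphism using (⟦⟧-cong; *-homo; 0#-homo)

    negateU-fixes-const : ∀ p → negateU p ≃ p → negateU ∘ const p ≋ const p
    negateU-fixes-const p fixed = pointwise (λ { zero → fixed ; (suc i) → P.refl })

    negateU-fixes-Y : negateU ∘ Y ≋ Y
    negateU-fixes-Y = pointwise (λ { zero → P.refl ; (suc zero) → P.refl ; (suc (suc i)) → P.refl })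

  conjugate-equation : ∀ {G} → Y ⊛ Y ⊛ quadratic ψ (const c₀) G ≋ 𝟘 → Y ⊛ Y ⊛ quadratic ψ (const c₀) (negateU ∘ G) ≋ 𝟘
  conjugate-equation {G} eqn = begin
    Y ⊛ Y ⊛ quadratic ψ (const c₀) (negateU ∘ G)                            ≈⟨ S.*-cong (S.*-cong negateU-fixes-Y negateU-fixes-Y)
                                                                                 (quadratic-homo negateUˢ-isRingHomomorphism ψ (const c₀) G
                                                                                    fixes-ψ (negateU-fixes-const c₀ P.refl)
                                                                                    (negateU-fixes-const (constP (ℚ.- 2ℚ)) P.refl)) ⟨
    (negateU ∘ Y) ⊛ (negateU ∘ Y) ⊛ (negateU ∘ quadratic ψ (const c₀) G)   ≈⟨ S.*-congʳ {negateU ∘ quadratic ψ (const c₀) G} (*-homo Y Y) ⟨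
    (negateU ∘ (Y ⊛ Y)) ⊛ (negateU ∘ quadratic ψ (const c₀) G)             ≈⟨ *-homo (Y ⊛ Y) (quadratic ψ (const c₀) G) ⟨
    negateU ∘ (Y ⊛ Y ⊛ quadratic ψ (const c₀) G)                            ≈⟨ ⟦⟧-cong eqn ⟩
    negateU ∘ 𝟘                                                              ≈⟨ 0#-homo ⟩
    𝟘                                                                        ∎
    where
    open import Relation.Binary.Reasoning.Setoid S.setoid
    fixes-ψ : ∀ k → negateU ∘ ψ k ≋ ψ k
    fixes-ψ k = S.trans (*-homo (φs M k) (Y ^ suc (toℕ k)))
      (S.*-cong (negateU-fixes-const (φP (toℕ k)) P.refl)
                (S.trans (^-homo negateUˢ-isRingHomomorphism Y (suc (toℕ k))) (^-congˡ (suc (toℕ k)) negateU-fixes-Y)))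

  NoNegPowers<-≋ : ∀ {n f g} → n ≤ suc M → f ≋ g → NoNegPowers< n f → NoNegPowers< n g
  NoNegPowers<-≋ n≤1+M f≋g = NoNegPowers<-cong (λ i i<n → agree-at f≋g i (ℕₚ.≤-pred (ℕₚ.≤-trans i<n n≤1+M)))

  NoNegPowers<-ψ⊛ : ∀ {n W} k → n ≤ M → NoNegPowers< n W → NoNegPowers< (suc n) (ψ k ⊛ W)
  NoNegPowers<-ψ⊛ {n} {W} k n≤M W⁺ = NoNegPowers<-≋ (s≤s n≤M)
    (solve 4 (λ c y q w → c :* (y :* (q :* w)) := c :* (y :* q) :* w) S.refl (φs M k) Y (Y ^ toℕ k) W)
    (NoNegPowers<-⊛ (NoNegPowers<-const (NoNegPowers-monomial 1ℚ 0 _))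
                    (NoNegPowers<-Y⊛ (NoNegPowers<-⊛ (^-closed (NoNegPowers<-ringClosed n) NoNegPowers<-Y (toℕ k)) W⁺)))
    where open ℚAlgebraSolver TruncatedAlgebra using (solve; _:=_; _:*_)

  c₀⁺ : NoNegPowers c₀
  c₀⁺ = NoNegPowers-+P (NoNegPowers-monomial 1ℚ 0 []) (NoNegPowers-·P (ℚ.- 1ℚ) (NoNegPowers-*P u⁺ u⁺))
    where
    u⁺ : NoNegPowers uP
    u⁺ = NoNegPowers-monomial 1ℚ 1 []

  module ConjugateRoots {G : Series} (eqn : Y ⊛ Y ⊛ quadratic ψ (const c₀) G ≋ 𝟘)
                        (cancellable : ∀ a → (G ⊕ ⊝ (negateU ∘ G)) 0 *P a ≃ 0P → a ≃ 0P) where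
    open Roots ψ (const c₀) G (negateU ∘ G)

    private
      vanishes : ∀ {R} → (G ⊕ ⊝ (negateU ∘ G)) ⊛ (Y ⊛ Y ⊛ R) ≋ 𝟘 → ∀ i → i ≤ N → R i ≃ 0P
      vanishes {R} D⊛Y²R≋0 i i≤N =
        Y²-factor {R} (cancelˡ {G ⊕ ⊝ (negateU ∘ G)} {Y ⊛ Y ⊛ R} cancellable D⊛Y²R≋0) i (s≤s (s≤s i≤N))

    s-recursion : ∀ i → i ≤ N → s i ≃ (⊝ τ ⊕ ⊝ const (constP (ℚ.- 2ℚ))) i
    s-recursion i i≤N = isolate (vanishes {s ⊕ τ ⊕ const (constP (ℚ.- 2ℚ))} (s-relation (Y ⊛ Y) eqn (conjugate-equation {G} eqn)) i i≤N)

    p-recursion : ∀ i → i ≤ N → p i ≃ (⊝ τ′ ⊕ ⊝ (⊝ const c₀)) i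
    p-recursion i i≤N = isolate (vanishes {p ⊕ τ′ ⊕ ⊝ const c₀} (p-relation (Y ⊛ Y) eqn (conjugate-equation {G} eqn)) i i≤N)

    -- both recursions raise the y-order, since every ψ k is divisible by y
    elementary-nonneg : ∀ n → n ≤ suc N → NoNegPowers< n s × NoNegPowers< n p
    elementary-nonneg zero    _         = (λ _ ()) , (λ _ ())
    elementary-nonneg (suc n) (s≤s n≤N) =
      NoNegPowers<-cong (λ i i≤n → P.sym (s-recursion i (below i≤n)))
        (NoNegPowers<-⊕ (NoNegPowers<-⊝ τ⁺) (NoNegPowers<-⊝ (NoNegPowers<-const (NoNegPowers-monomial _ 0 [])))) ,
      NoNegPowers<-cong (λ i i≤n → P.sym (p-recursion i (below i≤n)))
        (NoNegPowers<-⊕ (NoNegPowers<-⊝ τ′⁺) (NoNegPowers<-⊝ (NoNegPowers<-⊝ (NoNegPowers<-const c₀⁺))))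
      where
      s⁺p⁺ : NoNegPowers< n s × NoNegPowers< n p
      s⁺p⁺ = elementary-nonneg n (ℕₚ.m≤n⇒m≤1+n n≤N)
      below : ∀ {i} → i < suc n → i ≤ N
      below i<1+n = ℕₚ.≤-trans (ℕₚ.≤-pred i<1+n) n≤N
      n≤M : n ≤ M
      n≤M = ℕₚ.≤-trans n≤N (ℕₚ.m≤n+m N 2)
      h⁺ : ∀ j → NoNegPowers< n (h j)
      h⁺ = h-closed (NoNegPowers<-ringClosed n) (proj₁ s⁺p⁺) (proj₂ s⁺p⁺)
      τ⁺ : NoNegPowers< (suc n) τ
      τ⁺ = NoNegPowers<-sum (λ k → NoNegPowers<-ψ⊛ k n≤M (h⁺ (2 ℕ.+ toℕ k)))
      τ′⁺ : NoNegPowers< (suc n) τ′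
      τ′⁺ = NoNegPowers<-sum (λ k → NoNegPowers<-ψ⊛ k n≤M (NoNegPowers<-⊛ (proj₂ s⁺p⁺) (h⁺ (suc (toℕ k)))))

    powerSum-nonneg : ∀ r → NoNegPowers< (suc N) (G ^ r ⊕ (negateU ∘ G) ^ r)
    powerSum-nonneg r = NoNegPowers<-≋ (s≤s (ℕₚ.m≤n+m N 2)) (S.sym (powerSum-correct r))
      (powerSum-closed (NoNegPowers<-ringClosed (suc N)) (proj₁ s⁺p⁺) (proj₂ s⁺p⁺) r)
      where
      s⁺p⁺ : NoNegPowers< (suc N) s × NoNegPowers< (suc N) p
      s⁺p⁺ = elementary-nonneg (suc N) ℕₚ.≤-refl

module _ {Z : Ser} (isZ : IsZ Z) (N : ℕ) where
  open Modulo N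
  private
    module S = CommutativeRing TruncatedRing
    open import Algebra.Properties.CommutativeSemiring.Exp S.commutativeSemiring using (^-congˡ; ^-distrib-*)

    G Ḡ Z̄ : Series
    G = tail Z
    Ḡ = negateU ∘ G
    Z̄ = negateU ∘ Z

    Z₀≃0 : Z 0 ≃ 0P
    Z₀≃0 = coeffwise (proj₁ isZ)

    Z₁≃1-u : Z 1 ≃ 1P +P -P uP
    Z₁≃1-u = coeffwise (proj₁ (proj₂ isZ))

    leading-difference : (G ⊕ ⊝ Ḡ) 0 ≃ (ℚ.- 2ℚ , (+ 1 , [])) ∷ []
    leading-difference = P.trans (P.+-cong Z₁≃1-u (P.-‿cong (negateU-cong Z₁≃1-u)))
      (solve 1 (λ u → (con 1ℚ :- u) :- (con 1ℚ :+ u) := con (ℚ.- 2ℚ) :* u) P.refl uP)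
      where
      open ℚAlgebraSolver PolyAlgebra using (solve; _:=_; _:+_; _:-_; _:*_; con)

    cancellable : ∀ a → (G ⊕ ⊝ Ḡ) 0 *P a ≃ 0P → a ≃ 0P
    cancellable a D₀a≃0 = coeffwise (*P-cancel-monomial (ℚ.- 2ℚ) (ℚ.- ℚ.½) ≡.refl a
      (coeff≡ (P.trans (P.*-congʳ {a} (P.sym leading-difference)) D₀a≃0)))

    open ConjugateRoots {G} (reduced-equation {Z} Z₀≃0 (agree (λ i _ → coeffwise (proj₂ (proj₂ isZ) i)))) cancellable

    Z̄₀≃0 : Z̄ 0 ≃ 0P
    Z̄₀≃0 = negateU-cong Z₀≃0

    power-factor : ∀ {F} → F 0 ≃ 0P → ∀ r → F ^ r ≋ Y ^ r ⊛ tail F ^ r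
    power-factor F₀≃0 r = S.trans (^-congˡ r (≋-Y⊛tail F₀≃0)) (^-distrib-* Y _ r)

  powers-plus-conjugate-nonneg : ∀ r → NoNegPowers ((Z ^S r) N +P negateU ((Z ^S r) N))
  powers-plus-conjugate-nonneg r = NoNegPowers-cong (coeff≡ (P.sym coefficient-N))
    (NoNegPowers<-⊛ (^-closed (NoNegPowers<-ringClosed (suc N)) NoNegPowers<-Y r) (powerSum-nonneg r) N ℕₚ.≤-refl)
    where
    sum-factor : Z ^ r ⊕ Z̄ ^ r ≋ Y ^ r ⊛ (G ^ r ⊕ Ḡ ^ r)
    sum-factor = S.trans (S.+-cong (power-factor {Z} Z₀≃0 r) (power-factor {Z̄} Z̄₀≃0 r)) (S.sym (S.distribˡ (Y ^ r) (G ^ r) (Ḡ ^ r)))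
    coefficient-N : (Z ^S r) N +P negateU ((Z ^S r) N) ≃ (Y ^ r ⊛ (G ^ r ⊕ Ḡ ^ r)) N
    coefficient-N = begin
      (Z ^S r) N +P negateU ((Z ^S r) N)         ≈⟨ P.+-cong (^S≃^ Z r N) (negateU-cong (^S≃^ Z r N)) ⟩
      (Z ^ r) N +P negateU ((Z ^ r) N)           ≈⟨ P.+-cong P.refl (agree-at (^-homo negateUˢ-isRingHomomorphism Z r) N N≤M) ⟩
      (Z ^ r ⊕ Z̄ ^ r) N                          ≈⟨ agree-at sum-factor N N≤M ⟩
      (Y ^ r ⊛ (G ^ r ⊕ Ḡ ^ r)) N                ∎
      where
      open import Relation.Binary.Reasoning.Setoid P.setoid
      N≤M : N ≤ M
      N≤M = ℕₚ.m≤n+m N 2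

half-zero : ∀ c → c ℚ.+ c ≡ 0ℚ → c ≡ 0ℚ
half-zero c c+c≡0 = ≡.trans (halve c) (cong (ℚ.½ ℚ.*_) c+c≡0)
  where
  open +-*-Solver
  halve : ∀ c → c ≡ ℚ.½ ℚ.* (c ℚ.+ c)
  halve = solve 1 (λ c → c := con ℚ.½ :* (c :+ c)) ≡.refl

coeff-even-negative-vanishes : ∀ x → NoNegPowers (x +P negateU x) → ∀ k es →
                               coeff x (ℤ.- (+ (2 ℕ.* suc k)) , es) ≡ 0ℚ
coeff-even-negative-vanishes x x+x̄⁺ k es = half-zero (coeff x m) (begin
  coeff x m ℚ.+ coeff x m               ≡⟨ cong (coeff x m ℚ.+_) (ℚₚ.*-identityˡ (coeff x m)) ⟨
  coeff x m ℚ.+ 1ℚ ℚ.* coeff x m        ≡⟨ cong (λ σ → coeff x m ℚ.+ σ ℚ.* coeff x m) (neg1^ℕ-even (suc k)) ⟨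
  coeff x m ℚ.+ neg1^ (proj₁ m) ℚ.* coeff x m ≡⟨ cong (coeff x m ℚ.+_) (coeff-negateU x m) ⟨
  coeff x m ℚ.+ coeff (negateU x) m     ≡⟨ coeff-++ x (negateU x) m ⟨
  coeff (x +P negateU x) m              ≡⟨ coeff-negative x+x̄⁺ (k ℕ.+ suc (k ℕ.+ 0)) es ⟩
  0ℚ                                    ∎)
  where
  open ≡.≡-Reasoning
  m : Mono
  m = (ℤ.- (+ (2 ℕ.* suc k)) , es)

open import Data.Integer using (-_)
open import Data.Nat using (_*_)

lemma5 : (Z : Ser) → IsZ Z → (r n k : ℕ) → (es : Exps)
         → coeff ((Z ^S r) n) (- (+ (2 * suc k)) , es) ≡ 0ℚ
lemma5 Z isZ r n k es = coeff-even-negative-vanishes ((Z ^S r) n) (powers-plus-conjugate-nonneg isZ n r) k es
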